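{- Let $n\ge1$ and $0\le c\le n$. Let $x_1,\dots,x_n$ be pairwise distinct complex numbers, put $s_i=e_i(x_1,\dots,x_n)$ for $0\le i\le n$ and $s_i=0$ otherwise, and let $D^k_c$ be the $k\times k$ matrix with entries $(D_c^k)_{ij}=s_{j-i+c}$, $1\le i,j\le k$ (i.e. the leading $k\times k$ submatrix of $(s_{j-i})_{i,j\ge1}$ after deleting its first $c$ columns). Then for every $k\ge1$, $$\det D^k_c=\sum_{\tau\subseteq[n],\ |\tau|=c}\ \prod_{i\in\tau}x_i^k\prod_{i\in\tau,\ j\notin\tau}\frac{x_i}{x_i-x_j}.$$
   Context: $e_i$ denotes the $i$-th elementary symmetric polynomial; $[n]=\{1,\dots,n\}$. The $x_i$ are the zeros of $\chi(t)=\prod_{i=1}^n(t-x_i)$. -}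

module Defs where

open import Level using (Level; suc; _⊔_)
open import Data.Nat as ℕ using (ℕ; zero; _≡ᵇ_)
open import Data.Bool using (Bool; true; false; if_then_else_)
open import Data.Fin using (Fin; toℕ; punchIn)
open import Data.Vec using ([]; _∷_; lookup)
open import Data.Fin.Subset using (Subset; ∣_∣)
open import Data.Integer as ℤ using (ℤ; +_; -[1+_])
open import Relation.Nullary using (¬_)
open import Algebra.Bundles using (CommutativeRing)

-- A field: a commutative ring with 0 ≠ 1 and a (total) inverse operation
-- which is a genuine multiplicative inverse on every nonzero element
-- (the value 0⁻¹ is irrelevant; x / y := x * y⁻¹).
record Field (c ℓ : Level) : Set (suc (c ⊔ ℓ)) where
  field
    commutativeRing : CommutativeRing c ℓ
  open CommutativeRing commutativeRing public
  field
    _⁻¹      : Carrier → Carrier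
    ⁻¹-cong  : ∀ {x y} → x ≈ y → x ⁻¹ ≈ y ⁻¹
    ⁻¹-inverse : ∀ x → ¬ (x ≈ 0#) → x * (x ⁻¹) ≈ 1#
    0≉1      : ¬ (0# ≈ 1#)

  infixl 7 _/_
  _/_ : Carrier → Carrier → Carrier
  x / y = x * (y ⁻¹)

module FieldOps {c ℓ : Level} (F : Field c ℓ) where
  open Field F public

  pow : Carrier → ℕ → Carrier
  pow x zero = 1#
  pow x (ℕ.suc k) = x * pow x k

  Σfin : ∀ n → (Fin n → Carrier) → Carrier
  Σfin zero f = 0#
  Σfin (ℕ.suc n) f = f Fin.zero + Σfin n (λ i → f (Fin.suc i))

  Πfin : ∀ n → (Fin n → Carrier) → Carrier
  Πfin zero f = 1#
  Πfin (ℕ.suc n) f = f Fin.zero * Πfin n (λ i → f (Fin.suc i))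

  ΣSub : ∀ n → (Subset n → Carrier) → Carrier
  ΣSub zero f = f []
  ΣSub (ℕ.suc n) f = ΣSub n (λ p → f (false ∷ p)) + ΣSub n (λ p → f (true ∷ p))

  ΣSubCard : ∀ n → ℕ → (Subset n → Carrier) → Carrier
  ΣSubCard n c f = ΣSub n (λ τ → if ∣ τ ∣ ≡ᵇ c then f τ else 0#)

  Πin : ∀ {n} → Subset n → (Fin n → Carrier) → Carrier
  Πin {n} τ f = Πfin n (λ i → if lookup τ i then f i else 1#)

  Πout : ∀ {n} → Subset n → (Fin n → Carrier) → Carrier
  Πout {n} τ f = Πfin n (λ i → if lookup τ i then 1# else f i)

  e : ∀ {n} → ℕ → (Fin n → Carrier) → Carrier
  e {n} m x = ΣSubCard n m (λ τ → Πin τ x)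

  s : ∀ {n} → (Fin n → Carrier) → ℤ → Carrier
  s x (+ m) = e m x
  s x -[1+ m ] = 0#

  sign : ℕ → Carrier
  sign zero = 1#
  sign (ℕ.suc j) = - sign j

  det : ∀ k → (Fin k → Fin k → Carrier) → Carrier
  det zero M = 1#
  det (ℕ.suc k) M =
    Σfin (ℕ.suc k) (λ j → sign (toℕ j) * (M Fin.zero j * det k (λ a b → M (Fin.suc a) (punchIn j b))))

  -- D^k_c with (D^k_c)_{ij} = s_{j-i+c}, 1 ≤ i,j ≤ k (0-based indices here; same differences)
  D : ∀ {n} → (Fin n → Carrier) → ℕ → (k : ℕ) → Fin k → Fin k → Carrier
  D x c k i j = s x ((+ toℕ j ℤ.- + toℕ i) ℤ.+ + c)

module Submission where

open import Defs
open import Level using (Level)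
open import Data.Nat as ℕ using (ℕ; zero; suc; _∸_; _≡ᵇ_; _≤_; _≥_; _<_; z≤n; s≤s)
import Data.Nat.Properties as ℕP
open import Data.Fin as Fin using (Fin; zero; suc; toℕ; punchIn; splitAt; _↑ˡ_; _↑ʳ_; fromℕ<)
import Data.Fin.Properties as FinP
open import Data.Bool using (Bool; true; false; if_then_else_; T)
open import Data.Vec using ([]; _∷_; lookup; replicate)
open import Data.Fin.Subset using (Subset; ∣_∣)
open import Data.Sum as Sum using (_⊎_; inj₁; inj₂)
open import Data.Product using (_×_; _,_; proj₁)
open import Data.Integer as ℤ using (ℤ; +_; -[1+_])
import Data.Integer.Properties as ℤP
open import Data.Empty using (⊥-elim)
open import Relation.Binary.PropositionalEquality as ≡ using (_≡_; _≢_)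
open import Relation.Nullary using (¬_)
open import Algebra.Bundles using (CommutativeRing)

-- Let y_i = -x_i: these are the roots of Σ_m e_m(x) t^{n-m} = Π_l (t + x_l).
-- Write V(y) for the Vandermonde determinant, G(y) for the generalized
-- Vandermonde determinant whose first c columns have their exponents raised
-- by k, and Ω(y) = Σ_{|τ|=c} Π_{i∈τ} y_i^k Π_{i∈τ, j∉τ} y_i/(y_i - y_j).
--  1. Block matrix (ToeplitzBlock): put the unit rows of the columns
--     c, …, c+k-1 on top of the power rows of y.  Column operations built from
--     the e_m turn this matrix into one whose determinant is det D^k_c · V(y);
--     deleting the unit rows instead gives (-1)^{ck} G(y).
--  2. G(y) = V(y) Ω(y) (generalizedVandermonde): Laplace expansion along
--     column 0, removal of one point from V, and the Lagrange interpolation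
--     identity Σ_{i∈τ} y_i^m / Π_{j∈τ, j≠i} (y_i - y_j) = [m = |τ| - 1].
--  3. Ω(-x) = (-1)^{ck} Ω(x), and V(y) ≠ 0 cancels.

module ShiftedToeplitz {a ℓ : Level} (F : Field a ℓ) where

  open FieldOps F hiding (zero)
  open import Algebra.Properties.Ring ring
    using (-‿distribˡ-*; -‿distribʳ-*; -‿involutive; -‿+-comm; -0#≈0#; +-cancelʳ; x∙y⁻¹≈ε⇒x≈y; ⁻¹-anti-homo‿-)
  open import Relation.Binary.Reasoning.Setoid setoid
  open import Algebra.Solver.Ring.NaturalCoefficients.Default (CommutativeRing.commutativeSemiring commutativeRing)
    using (solve; _:=_; _:+_; _:*_)

  neg-*-neg : ∀ x y → (- x) * (- y) ≈ x * y
  neg-*-neg x y = begin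
    (- x) * (- y)   ≈⟨ -‿distribˡ-* x (- y) ⟨
    - (x * - y)     ≈⟨ -‿cong (-‿distribʳ-* x y) ⟨
    - - (x * y)     ≈⟨ -‿involutive _ ⟩
    x * y           ∎

  sign-sq : ∀ j → sign j * sign j ≈ 1#
  sign-sq zero = *-identityˡ 1#
  sign-sq (suc j) = trans (neg-*-neg (sign j) (sign j)) (sign-sq j)

  sign-+ : ∀ m n → sign (m ℕ.+ n) ≈ sign m * sign n
  sign-+ zero n = sym (*-identityˡ _)
  sign-+ (suc m) n = trans (-‿cong (sign-+ m n)) (-‿distribˡ-* _ _)

  pow-sign : ∀ m n → pow (sign m) n ≈ sign (m ℕ.* n)
  pow-sign m zero = reflexive (≡.cong sign (≡.sym (ℕP.*-zeroʳ m)))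
  pow-sign m (suc n) = begin
    sign m * pow (sign m) n   ≈⟨ *-cong refl (pow-sign m n) ⟩
    sign m * sign (m ℕ.* n)   ≈⟨ sign-+ m (m ℕ.* n) ⟨
    sign (m ℕ.+ m ℕ.* n)      ≡⟨ ≡.cong sign (ℕP.*-suc m n) ⟨
    sign (m ℕ.* suc n)        ∎

  pow-+ : ∀ z m n → pow z (m ℕ.+ n) ≈ pow z m * pow z n
  pow-+ z zero n = sym (*-identityˡ _)
  pow-+ z (suc m) n = trans (*-cong refl (pow-+ z m n)) (sym (*-assoc _ _ _))

  pow-neg : ∀ z k → pow (- z) k ≈ sign k * pow z k
  pow-neg z zero = sym (*-identityˡ 1#)
  pow-neg z (suc k) = begin
    (- z) * pow (- z) k          ≈⟨ *-cong refl (pow-neg z k) ⟩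
    (- z) * (sign k * pow z k)   ≈⟨ -‿distribˡ-* _ _ ⟨
    - (z * (sign k * pow z k))   ≈⟨ -‿cong (solve 3 (λ z s p → z :* (s :* p) := s :* (z :* p)) refl _ _ _) ⟩
    - (sign k * (z * pow z k))   ≈⟨ -‿distribˡ-* _ _ ⟩
    (- sign k) * (z * pow z k)   ∎

  1≉0 : ¬ (1# ≈ 0#)
  1≉0 eq = 0≉1 (sym eq)

  *-cancelˡ-nonzero : ∀ v a b → ¬ (v ≈ 0#) → v * a ≈ v * b → a ≈ b
  *-cancelˡ-nonzero v a b v≉0 eq = begin
    a                    ≈⟨ *-identityˡ a ⟨
    1# * a               ≈⟨ *-cong (trans (*-comm _ _) (⁻¹-inverse v v≉0)) refl ⟨
    (v ⁻¹ * v) * a       ≈⟨ *-assoc _ _ _ ⟩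
    v ⁻¹ * (v * a)       ≈⟨ *-cong refl eq ⟩
    v ⁻¹ * (v * b)       ≈⟨ *-assoc _ _ _ ⟨
    (v ⁻¹ * v) * b       ≈⟨ *-cong (trans (*-comm _ _) (⁻¹-inverse v v≉0)) refl ⟩
    1# * b               ≈⟨ *-identityˡ b ⟩
    b                    ∎

  *-nonzero : ∀ {a b} → ¬ (a ≈ 0#) → ¬ (b ≈ 0#) → ¬ (a * b ≈ 0#)
  *-nonzero {a} {b} a≉0 b≉0 ab≈0 =
    b≉0 (*-cancelˡ-nonzero a b 0# a≉0 (trans ab≈0 (sym (zeroʳ a))))

  -‿nonzero : ∀ {a} → ¬ (a ≈ 0#) → ¬ (- a ≈ 0#)
  -‿nonzero {a} a≉0 eq = a≉0 (trans (sym (-‿involutive a)) (trans (-‿cong eq) -0#≈0#))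

  difference-nonzero : ∀ {a b} → ¬ (a ≈ b) → ¬ (a - b ≈ 0#)
  difference-nonzero {a} {b} a≉b eq = a≉b (x∙y⁻¹≈ε⇒x≈y a b eq)

  ⁻¹-unique : ∀ a b → ¬ (a ≈ 0#) → a * b ≈ 1# → b ≈ a ⁻¹
  ⁻¹-unique a b a≉0 ab≈1 =
    *-cancelˡ-nonzero a b (a ⁻¹) a≉0 (trans ab≈1 (sym (⁻¹-inverse a a≉0)))

  ⁻¹-neg : ∀ a → ¬ (a ≈ 0#) → (- a) ⁻¹ ≈ - (a ⁻¹)
  ⁻¹-neg a a≉0 = sym (⁻¹-unique (- a) (- (a ⁻¹)) (-‿nonzero a≉0)
                        (trans (neg-*-neg a (a ⁻¹)) (⁻¹-inverse a a≉0)))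

  Σ-cong : ∀ n {f g : Fin n → Carrier} → (∀ i → f i ≈ g i) → Σfin n f ≈ Σfin n g
  Σ-cong zero eq = refl
  Σ-cong (suc n) eq = +-cong (eq zero) (Σ-cong n (λ i → eq (suc i)))

  Σ-zero : ∀ n {f : Fin n → Carrier} → (∀ i → f i ≈ 0#) → Σfin n f ≈ 0#
  Σ-zero zero eq = refl
  Σ-zero (suc n) eq = trans (+-cong (eq zero) (Σ-zero n (λ i → eq (suc i)))) (+-identityˡ 0#)

  Σ-+ : ∀ n (f g : Fin n → Carrier) → Σfin n (λ i → f i + g i) ≈ Σfin n f + Σfin n g
  Σ-+ zero f g = sym (+-identityˡ 0#)
  Σ-+ (suc n) f g = trans (+-cong refl (Σ-+ n (λ i → f (suc i)) (λ i → g (suc i))))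
    (solve 4 (λ a b c d → (a :+ b) :+ (c :+ d) := (a :+ c) :+ (b :+ d)) refl (f zero) (g zero) _ _)

  Σ-*ˡ : ∀ n c (f : Fin n → Carrier) → c * Σfin n f ≈ Σfin n (λ i → c * f i)
  Σ-*ˡ zero c f = zeroʳ c
  Σ-*ˡ (suc n) c f = trans (distribˡ c _ _) (+-cong refl (Σ-*ˡ n c (λ i → f (suc i))))

  Σ-neg : ∀ n (f : Fin n → Carrier) → - Σfin n f ≈ Σfin n (λ i → - f i)
  Σ-neg zero f = -0#≈0#
  Σ-neg (suc n) f = trans (sym (-‿+-comm _ _)) (+-cong refl (Σ-neg n (λ i → f (suc i))))

  Σ-swap : ∀ m n (f : Fin m → Fin n → Carrier) →
    Σfin m (λ i → Σfin n (f i)) ≈ Σfin n (λ j → Σfin m (λ i → f i j))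
  Σ-swap zero n f = sym (Σ-zero n (λ _ → refl))
  Σ-swap (suc m) n f =
    trans (+-cong refl (Σ-swap m n (λ i → f (suc i)))) (sym (Σ-+ n (f zero) _))

  Σ-punchIn : ∀ n (i : Fin (suc n)) (f : Fin (suc n) → Carrier) →
    Σfin (suc n) f ≈ f i + Σfin n (λ j → f (punchIn i j))
  Σ-punchIn n zero f = refl
  Σ-punchIn (suc n) (suc i) f =
    trans (+-cong refl (Σ-punchIn n i (λ j → f (suc j))))
          (solve 3 (λ a b c → a :+ (b :+ c) := b :+ (a :+ c)) refl (f zero) _ _)

  Σ-++ : ∀ m n (f : Fin (m ℕ.+ n) → Carrier) →
    Σfin (m ℕ.+ n) f ≈ Σfin m (λ b → f (b ↑ˡ n)) + Σfin n (λ i → f (m ↑ʳ i))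
  Σ-++ zero n f = sym (+-identityˡ _)
  Σ-++ (suc m) n f = trans (+-cong refl (Σ-++ m n (λ i → f (suc i)))) (sym (+-assoc _ _ _))

  Π-cong : ∀ n {f g : Fin n → Carrier} → (∀ i → f i ≈ g i) → Πfin n f ≈ Πfin n g
  Π-cong zero eq = refl
  Π-cong (suc n) eq = *-cong (eq zero) (Π-cong n (λ i → eq (suc i)))

  Π-one : ∀ n {f : Fin n → Carrier} → (∀ i → f i ≈ 1#) → Πfin n f ≈ 1#
  Π-one zero eq = refl
  Π-one (suc n) eq = trans (*-cong (eq zero) (Π-one n (λ i → eq (suc i)))) (*-identityˡ 1#)

  Π-zero : ∀ n (i : Fin n) (f : Fin n → Carrier) → f i ≈ 0# → Πfin n f ≈ 0#
  Π-zero (suc n) zero f eq = trans (*-cong eq refl) (zeroˡ _)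
  Π-zero (suc n) (suc i) f eq = trans (*-cong refl (Π-zero n i (λ j → f (suc j)) eq)) (zeroʳ _)

  Π-* : ∀ n (f g : Fin n → Carrier) → Πfin n (λ i → f i * g i) ≈ Πfin n f * Πfin n g
  Π-* zero f g = sym (*-identityˡ 1#)
  Π-* (suc n) f g = trans (*-cong refl (Π-* n (λ i → f (suc i)) (λ i → g (suc i))))
    (solve 4 (λ a b c d → (a :* b) :* (c :* d) := (a :* c) :* (b :* d)) refl (f zero) (g zero) _ _)

  Π-punchIn : ∀ n (i : Fin (suc n)) (f : Fin (suc n) → Carrier) →
    Πfin (suc n) f ≈ f i * Πfin n (λ j → f (punchIn i j))
  Π-punchIn n zero f = refl
  Π-punchIn (suc n) (suc i) f =
    trans (*-cong refl (Π-punchIn n i (λ j → f (suc j))))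
          (solve 3 (λ a b c → a :* (b :* c) := b :* (a :* c)) refl (f zero) _ _)

  Π-nonzero : ∀ n (f : Fin n → Carrier) → (∀ i → ¬ (f i ≈ 0#)) → ¬ (Πfin n f ≈ 0#)
  Π-nonzero zero f nz = 1≉0
  Π-nonzero (suc n) f nz = *-nonzero (nz zero) (Π-nonzero n (λ i → f (suc i)) (λ i → nz (suc i)))

  Π-inverse : ∀ n (f : Fin n → Carrier) → (∀ i → ¬ (f i ≈ 0#)) →
    Πfin n f * Πfin n (λ i → f i ⁻¹) ≈ 1#
  Π-inverse n f nz = trans (sym (Π-* n f (λ i → f i ⁻¹))) (Π-one n (λ i → ⁻¹-inverse (f i) (nz i)))

  -- Determinants.  Defs defines det by Laplace expansion along the first
  -- row; the column properties used below follow from it: additivity and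
  -- homogeneity in column 0, the sign rule for moving a column to the front,
  -- vanishing for a repeated column, invariance under adding multiples of
  -- other columns to column 0, and Laplace expansion along column 0.

  Matrix : ℕ → Set a
  Matrix k = Fin k → Fin k → Carrier

  det-cong : ∀ k {M N : Matrix k} → (∀ i j → M i j ≈ N i j) → det k M ≈ det k N
  det-cong zero eq = refl
  det-cong (suc k) eq = Σ-cong (suc k) (λ j → *-cong (refl {sign (toℕ j)}) (*-cong (eq zero j)
                          (det-cong k (λ a b → eq (suc a) (punchIn j b)))))

  rowTerm : ∀ k → Matrix (suc k) → Fin (suc k) → Carrier
  rowTerm k M j = sign (toℕ j) * (M zero j * det k (λ a b → M (suc a) (punchIn j b)))

  setColumn₀ : ∀ {k} → Matrix (suc k) → (Fin (suc k) → Carrier) → Matrix (suc k)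
  setColumn₀ M v r zero = v r
  setColumn₀ M v r (suc j) = M r (suc j)

  mutual
    det-additive₀ : ∀ k (A B P : Matrix (suc k)) →
      (∀ r → P r zero ≈ A r zero + B r zero) →
      (∀ r j → P r (suc j) ≈ A r (suc j)) → (∀ r j → P r (suc j) ≈ B r (suc j)) →
      det (suc k) P ≈ det (suc k) A + det (suc k) B
    det-additive₀ k A B P e₀ eA eB =
      trans (Σ-cong (suc k) (rowTerm-additive₀ k A B P e₀ eA eB)) (Σ-+ (suc k) (rowTerm k A) (rowTerm k B))

    -- Termwise: the term of column 0 is linear in its entry, and every other
    -- term has a minor that contains column 0, handled by induction.
    rowTerm-additive₀ : ∀ k (A B P : Matrix (suc k)) →
      (∀ r → P r zero ≈ A r zero + B r zero) →
      (∀ r j → P r (suc j) ≈ A r (suc j)) → (∀ r j → P r (suc j) ≈ B r (suc j)) →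
      ∀ j → rowTerm k P j ≈ rowTerm k A j + rowTerm k B j
    rowTerm-additive₀ k A B P e₀ eA eB zero = begin
      sign 0 * (P zero zero * det k (λ a b → P (suc a) (suc b)))
        ≈⟨ *-cong refl (*-cong (e₀ zero) (det-cong k (λ a b → eA (suc a) b))) ⟩
      sign 0 * ((A zero zero + B zero zero) * det k (λ a b → A (suc a) (suc b)))
        ≈⟨ solve 4 (λ s x y d → s :* ((x :+ y) :* d) := s :* (x :* d) :+ s :* (y :* d)) refl _ _ _ _ ⟩
      rowTerm k A zero + sign 0 * (B zero zero * det k (λ a b → A (suc a) (suc b)))
        ≈⟨ +-cong refl (*-cong refl (*-cong refl (det-cong k (λ a b → trans (sym (eA (suc a) b)) (eB (suc a) b))))) ⟩
      rowTerm k A zero + rowTerm k B zero ∎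
    rowTerm-additive₀ (suc k) A B P e₀ eA eB (suc j) = begin
      rowTerm (suc k) P (suc j)
        ≈⟨ *-cong refl (*-cong refl (det-additive₀ k (minor A) (minor B) (minor P)
             (λ r → e₀ (suc r)) (λ r j' → eA (suc r) (punchIn j j')) (λ r j' → eB (suc r) (punchIn j j')))) ⟩
      sign (toℕ (suc j)) * (P zero (suc j) * (det (suc k) (minor A) + det (suc k) (minor B)))
        ≈⟨ solve 4 (λ s x y d → s :* (x :* (y :+ d)) := s :* (x :* y) :+ s :* (x :* d)) refl _ _ _ _ ⟩
      sign (toℕ (suc j)) * (P zero (suc j) * det (suc k) (minor A)) + sign (toℕ (suc j)) * (P zero (suc j) * det (suc k) (minor B))
        ≈⟨ +-cong (*-cong refl (*-cong (eA zero j) refl)) (*-cong refl (*-cong (eB zero j) refl)) ⟩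
      rowTerm (suc k) A (suc j) + rowTerm (suc k) B (suc j) ∎
      where
      minor : Matrix (suc (suc k)) → Matrix (suc k)
      minor M a b = M (suc a) (punchIn (suc j) b)

  mutual
    det-homogeneous₀ : ∀ k (c : Carrier) (A P : Matrix (suc k)) →
      (∀ r → P r zero ≈ c * A r zero) → (∀ r j → P r (suc j) ≈ A r (suc j)) →
      det (suc k) P ≈ c * det (suc k) A
    det-homogeneous₀ k c A P e₀ eA =
      trans (Σ-cong (suc k) (rowTerm-homogeneous₀ k c A P e₀ eA)) (sym (Σ-*ˡ (suc k) c (rowTerm k A)))

    rowTerm-homogeneous₀ : ∀ k (c : Carrier) (A P : Matrix (suc k)) →
      (∀ r → P r zero ≈ c * A r zero) → (∀ r j → P r (suc j) ≈ A r (suc j)) →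
      ∀ j → rowTerm k P j ≈ c * rowTerm k A j
    rowTerm-homogeneous₀ k c A P e₀ eA zero =
      trans (*-cong refl (*-cong (e₀ zero) (det-cong k (λ a b → eA (suc a) b))))
            (solve 4 (λ s x y d → s :* ((x :* y) :* d) := x :* (s :* (y :* d))) refl _ _ _ _)
    rowTerm-homogeneous₀ (suc k) c A P e₀ eA (suc j) =
      trans (*-cong refl (*-cong (eA zero j)
               (det-homogeneous₀ k c (λ a b → A (suc a) (punchIn (suc j) b)) (λ a b → P (suc a) (punchIn (suc j) b))
                 (λ r → e₀ (suc r)) (λ r j' → eA (suc r) (punchIn j j')))))
            (solve 4 (λ s x y d → s :* (y :* (x :* d)) := x :* (s :* (y :* d))) refl _ _ _ _)

  toFront : ∀ {k} → Fin (suc k) → Fin (suc k) → Fin (suc k)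
  toFront m zero = m
  toFront m (suc j) = punchIn m j

  -- The position of column m among the columns other than punchIn m j.
  positionOf : ∀ {k} → Fin (suc k) → Fin k → Fin k
  positionOf {suc k} zero j = zero
  positionOf (suc m) zero = m
  positionOf (suc m) (suc j) = suc (positionOf m j)

  positionOf-correct : ∀ {k} (m : Fin (suc k)) (j : Fin k) → punchIn (punchIn m j) (positionOf m j) ≡ m
  positionOf-correct {suc k} zero j = ≡.refl
  positionOf-correct (suc m) zero = ≡.refl
  positionOf-correct (suc m) (suc j) = ≡.cong suc (positionOf-correct m j)

  positionOf-punchIn : ∀ {k} (m : Fin (suc (suc k))) (j : Fin (suc k)) (b : Fin k) →
    punchIn (punchIn m j) (punchIn (positionOf m j) b) ≡ punchIn m (punchIn j b)
  positionOf-punchIn zero j b = ≡.refl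
  positionOf-punchIn (suc m) zero b = ≡.refl
  positionOf-punchIn (suc m) (suc j) zero = ≡.refl
  positionOf-punchIn (suc m) (suc j) (suc b) = ≡.cong suc (positionOf-punchIn m j b)

  -- Sign bookkeeping for det-toFront: both ways of deleting the two columns
  -- m and punchIn m j carry the same sign.
  positionOf-sign : ∀ {k} (m : Fin (suc k)) (j : Fin k) →
    sign (toℕ (suc j)) * sign (toℕ (positionOf m j)) ≈ sign (toℕ m) * sign (toℕ (punchIn m j))
  positionOf-sign {suc k} zero j = *-comm _ _
  positionOf-sign (suc m) zero =
    trans (sym (-‿distribˡ-* 1# _)) (trans (-‿cong (*-comm 1# _)) (-‿distribˡ-* _ 1#))
  positionOf-sign (suc m) (suc j) = begin
    (- - sign (toℕ j)) * (- sign (toℕ (positionOf m j)))  ≈⟨ neg-*-neg _ _ ⟩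
    (- sign (toℕ j)) * sign (toℕ (positionOf m j))        ≈⟨ positionOf-sign m j ⟩
    sign (toℕ m) * sign (toℕ (punchIn m j))               ≈⟨ neg-*-neg _ _ ⟨
    (- sign (toℕ m)) * (- sign (toℕ (punchIn m j)))       ∎

  det-toFront : ∀ k (N : Matrix (suc k)) (m : Fin (suc k)) →
    det (suc k) (λ r j → N r (toFront m j)) ≈ sign (toℕ m) * det (suc k) N
  det-toFront k N m = begin
    rowTerm k L zero + Σfin k (λ j → rowTerm k L (suc j))
      ≈⟨ +-cong firstTerm (Σ-cong k (otherTerms k N m)) ⟩
    sign (toℕ m) * rowTerm k N m + Σfin k (λ j → sign (toℕ m) * rowTerm k N (punchIn m j))
      ≈⟨ +-cong refl (Σ-*ˡ k _ _) ⟨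
    sign (toℕ m) * rowTerm k N m + sign (toℕ m) * Σfin k (λ j → rowTerm k N (punchIn m j))
      ≈⟨ distribˡ _ _ _ ⟨
    sign (toℕ m) * (rowTerm k N m + Σfin k (λ j → rowTerm k N (punchIn m j)))
      ≈⟨ *-cong refl (Σ-punchIn k m (rowTerm k N)) ⟨
    sign (toℕ m) * det (suc k) N ∎
    where
    L : Matrix (suc k)
    L r j = N r (toFront m j)
    firstTerm : rowTerm k L zero ≈ sign (toℕ m) * rowTerm k N m
    firstTerm = trans (*-cong (sym (sign-sq (toℕ m))) refl) (*-assoc _ _ _)
    -- The other terms: the minor of L is the minor of N with column m moved
    -- to the front, which by induction costs the sign (-1)^(positionOf m j).
    otherTerms : ∀ k (N : Matrix (suc k)) (m : Fin (suc k)) (j : Fin k) →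
      rowTerm k (λ r j' → N r (toFront m j')) (suc j) ≈ sign (toℕ m) * rowTerm k N (punchIn m j)
    otherTerms (suc k) N m j = begin
      sign (toℕ (suc j)) * (N zero (punchIn m j) * det (suc k) (λ a b → N (suc a) (toFront m (punchIn (suc j) b))))
        ≈⟨ *-cong refl (*-cong refl (det-cong (suc k) reindex)) ⟩
      sign (toℕ (suc j)) * (N zero (punchIn m j) * det (suc k) (λ a b → Nj a (toFront (positionOf m j) b)))
        ≈⟨ *-cong refl (*-cong refl (det-toFront k Nj (positionOf m j))) ⟩
      sign (toℕ (suc j)) * (N zero (punchIn m j) * (sign (toℕ (positionOf m j)) * det (suc k) Nj))
        ≈⟨ solve 4 (λ s t x d → s :* (x :* (t :* d)) := (s :* t) :* (x :* d)) refl _ _ _ _ ⟩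
      (sign (toℕ (suc j)) * sign (toℕ (positionOf m j))) * (N zero (punchIn m j) * det (suc k) Nj)
        ≈⟨ *-cong (positionOf-sign m j) refl ⟩
      (sign (toℕ m) * sign (toℕ (punchIn m j))) * (N zero (punchIn m j) * det (suc k) Nj)
        ≈⟨ *-assoc _ _ _ ⟩
      sign (toℕ m) * rowTerm (suc k) N (punchIn m j) ∎
      where
      Nj : Matrix (suc k)
      Nj a b = N (suc a) (punchIn (punchIn m j) b)
      reindex : ∀ a b → N (suc a) (toFront m (punchIn (suc j) b)) ≈ Nj a (toFront (positionOf m j) b)
      reindex a zero = reflexive (≡.cong (N (suc a)) (≡.sym (positionOf-correct m j)))
      reindex a (suc b) = reflexive (≡.cong (N (suc a)) (≡.sym (positionOf-punchIn m j b)))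

  -- If column 0 equals column q+1, the first-row terms of these two columns
  -- cancel: their minors differ by moving one column q places.
  rowTerm-repeatedColumn₀ : ∀ k (M : Matrix (suc (suc k))) (q : Fin (suc k)) →
    (∀ r → M r zero ≈ M r (suc q)) → rowTerm (suc k) M (suc q) ≈ - rowTerm (suc k) M zero
  rowTerm-repeatedColumn₀ k M q eq = begin
    (- sign (toℕ q)) * (M zero (suc q) * det (suc k) (λ a b → M (suc a) (punchIn (suc q) b)))
      ≈⟨ *-cong refl (*-cong (sym (eq zero)) (det-cong (suc k) reindex)) ⟩
    (- sign (toℕ q)) * (M zero zero * det (suc k) (λ a b → M₀ a (toFront q b)))
      ≈⟨ *-cong refl (*-cong refl (det-toFront k M₀ q)) ⟩
    (- sign (toℕ q)) * (M zero zero * (sign (toℕ q) * det (suc k) M₀))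
      ≈⟨ -‿distribˡ-* _ _ ⟨
    - (sign (toℕ q) * (M zero zero * (sign (toℕ q) * det (suc k) M₀)))
      ≈⟨ -‿cong (solve 3 (λ s x d → s :* (x :* (s :* d)) := (s :* s) :* (x :* d)) refl _ _ _) ⟩
    - ((sign (toℕ q) * sign (toℕ q)) * (M zero zero * det (suc k) M₀))
      ≈⟨ -‿cong (*-cong (sign-sq (toℕ q)) refl) ⟩
    - rowTerm (suc k) M zero ∎
    where
    M₀ : Matrix (suc k)
    M₀ a b = M (suc a) (suc b)
    reindex : ∀ a b → M (suc a) (punchIn (suc q) b) ≈ M₀ a (toFront q b)
    reindex a zero = eq (suc a)
    reindex a (suc b) = refl

  det-repeatedColumn₀ : ∀ k (M : Matrix (suc k)) (q : Fin k) →
    (∀ r → M r zero ≈ M r (suc q)) → det (suc k) M ≈ 0#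
  det-repeatedColumn₀ (suc k) M q eq = begin
    rowTerm (suc k) M zero + Σfin (suc k) (λ j → rowTerm (suc k) M (suc j))
      ≈⟨ +-cong refl (Σ-punchIn k q (λ j → rowTerm (suc k) M (suc j))) ⟩
    rowTerm (suc k) M zero + (rowTerm (suc k) M (suc q) + Σfin k (λ j → rowTerm (suc k) M (suc (punchIn q j))))
      ≈⟨ +-cong refl (+-cong (rowTerm-repeatedColumn₀ k M q eq) (Σ-zero k otherTerms)) ⟩
    rowTerm (suc k) M zero + (- rowTerm (suc k) M zero + 0#)
      ≈⟨ +-cong refl (+-identityʳ _) ⟩
    rowTerm (suc k) M zero + - rowTerm (suc k) M zero
      ≈⟨ -‿inverseʳ _ ⟩
    0# ∎
    where
    -- Every other minor still contains both equal columns.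
    otherTerms : ∀ j → rowTerm (suc k) M (suc (punchIn q j)) ≈ 0#
    otherTerms j = trans (*-cong refl (*-cong refl (det-repeatedColumn₀ k Mj (positionOf q j) repeated)))
                         (trans (*-cong refl (zeroʳ _)) (zeroʳ _))
      where
      Mj : Matrix (suc k)
      Mj a b = M (suc a) (punchIn (suc (punchIn q j)) b)
      repeated : ∀ r → Mj r zero ≈ Mj r (suc (positionOf q j))
      repeated r = trans (eq (suc r)) (reflexive (≡.cong (λ z → M (suc r) (suc z)) (≡.sym (positionOf-correct q j))))

  -- By induction on the number L of added columns: by additivity, each added
  -- multiple contributes the determinant of a matrix with a repeated column.
  det-addColumns₀ : ∀ k L (M M' : Matrix (suc k)) (c : Fin L → Carrier) (g : Fin L → Fin k) →
    (∀ r → M' r zero ≈ M r zero + Σfin L (λ t → c t * M r (suc (g t)))) →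
    (∀ r j → M' r (suc j) ≈ M r (suc j)) → det (suc k) M' ≈ det (suc k) M
  det-addColumns₀ k zero M M' c g e₀ eS = det-cong (suc k) same
    where
    same : ∀ i j → M' i j ≈ M i j
    same i zero = trans (e₀ i) (+-identityʳ _)
    same i (suc j) = eS i j
  det-addColumns₀ k (suc L) M M' c g e₀ eS = begin
    det (suc k) M'                    ≈⟨ det-additive₀ k A B M' split eS eS ⟩
    det (suc k) A + det (suc k) B     ≈⟨ +-cong detA (det-addColumns₀ k L M B (λ t → c (suc t)) (λ t → g (suc t)) (λ r → refl) (λ r j → refl)) ⟩
    0# + det (suc k) M                ≈⟨ +-identityˡ _ ⟩
    det (suc k) M                     ∎
    where
    A B Rep : Matrix (suc k)
    Rep = setColumn₀ M (λ r → M r (suc (g zero)))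
    A = setColumn₀ M (λ r → c zero * M r (suc (g zero)))
    B = setColumn₀ M (λ r → M r zero + Σfin L (λ t → c (suc t) * M r (suc (g (suc t)))))
    split : ∀ r → M' r zero ≈ A r zero + B r zero
    split r = trans (e₀ r) (solve 3 (λ m x s → m :+ (x :+ s) := x :+ (m :+ s)) refl _ _ _)
    detA : det (suc k) A ≈ 0#
    detA = trans (det-homogeneous₀ k (c zero) Rep A (λ r → refl) (λ r j → refl))
                 (trans (*-cong refl (det-repeatedColumn₀ k Rep (g zero) (λ r → refl))) (zeroʳ _))

  Σ-*ˡ₂ : ∀ n a b (f : Fin n → Carrier) → a * (b * Σfin n f) ≈ Σfin n (λ i → a * (b * f i))
  Σ-*ˡ₂ n a b f = trans (*-cong refl (Σ-*ˡ n b f)) (Σ-*ˡ n a _)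

  -- (-1)^{i+1} (-1)^j = (-1)^{j+1} (-1)^i, the sign identity behind the
  -- symmetry of the row and column expansions.
  sign-suc-swap : ∀ i j → sign (suc i) * sign j ≈ sign (suc j) * sign i
  sign-suc-swap i j = begin
    (- sign i) * sign j    ≈⟨ -‿distribˡ-* _ _ ⟨
    - (sign i * sign j)    ≈⟨ -‿cong (*-comm _ _) ⟩
    - (sign j * sign i)    ≈⟨ -‿distribˡ-* _ _ ⟩
    (- sign j) * sign i    ∎

  -- Laplace expansion along column 0: expanding every first-row minor along
  -- its first column and exchanging the two sums.
  det-expandColumn₀ : ∀ k (M : Matrix (suc k)) →
    det (suc k) M ≈ Σfin (suc k) (λ i → sign (toℕ i) * (M i zero * det k (λ a b → M (punchIn i a) (suc b))))
  det-expandColumn₀ zero M = refl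
  det-expandColumn₀ (suc k) M = +-cong refl (begin
    Σfin (suc k) (λ j → rowTerm (suc k) M (suc j))
      ≈⟨ Σ-cong (suc k) (λ j → *-cong (refl {sign (toℕ (suc j))}) (*-cong (refl {M zero (suc j)}) (det-expandColumn₀ k (λ a b → M (suc a) (punchIn (suc j) b))))) ⟩
    Σfin (suc k) (λ j → sign (toℕ (suc j)) * (M zero (suc j) * Σfin (suc k) (λ i → sign (toℕ i) * (M (suc i) zero * Dm i j))))
      ≈⟨ Σ-cong (suc k) (λ j → Σ-*ˡ₂ (suc k) (sign (toℕ (suc j))) (M zero (suc j)) (λ i → sign (toℕ i) * (M (suc i) zero * Dm i j))) ⟩
    Σfin (suc k) (λ j → Σfin (suc k) (λ i → byRow i j))
      ≈⟨ Σ-swap (suc k) (suc k) byRow ⟨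
    Σfin (suc k) (λ i → Σfin (suc k) (λ j → byRow i j))
      ≈⟨ Σ-cong (suc k) (λ i → Σ-cong (suc k) (λ j → rowToColumn i j)) ⟩
    Σfin (suc k) (λ i → Σfin (suc k) (λ j → byColumn i j))
      ≈⟨ Σ-cong (suc k) (λ i → Σ-*ˡ₂ (suc k) (sign (toℕ (suc i))) (M (suc i) zero) (λ j → sign (toℕ j) * (M zero (suc j) * Dm i j))) ⟨
    Σfin (suc k) (λ i → sign (toℕ (suc i)) * (M (suc i) zero * Σfin (suc k) (λ j → sign (toℕ j) * (M zero (suc j) * Dm i j)))) ∎)
    where
    Dm : Fin (suc k) → Fin (suc k) → Carrier
    Dm i j = det k (λ a b → M (suc (punchIn i a)) (suc (punchIn j b)))
    byRow byColumn : Fin (suc k) → Fin (suc k) → Carrier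
    byRow i j = sign (toℕ (suc j)) * (M zero (suc j) * (sign (toℕ i) * (M (suc i) zero * Dm i j)))
    byColumn i j = sign (toℕ (suc i)) * (M (suc i) zero * (sign (toℕ j) * (M zero (suc j) * Dm i j)))
    rowToColumn : ∀ i j → byRow i j ≈ byColumn i j
    rowToColumn i j = begin
      byRow i j
        ≈⟨ solve 5 (λ s t x y d → s :* (x :* (t :* (y :* d))) := (s :* t) :* ((x :* y) :* d)) refl _ _ _ _ _ ⟩
      (sign (toℕ (suc j)) * sign (toℕ i)) * ((M zero (suc j) * M (suc i) zero) * Dm i j)
        ≈⟨ *-cong (sign-suc-swap (toℕ i) (toℕ j)) refl ⟨
      (sign (toℕ (suc i)) * sign (toℕ j)) * ((M zero (suc j) * M (suc i) zero) * Dm i j)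
        ≈⟨ solve 5 (λ s t x y d → (s :* t) :* ((x :* y) :* d) := s :* (y :* (t :* (x :* d)))) refl _ _ _ _ _ ⟩
      byColumn i j ∎

  guard : Bool → Carrier → Carrier
  guard b x = if b then x else 0#

  guard-cong : ∀ b {x y} → (b ≡ true → x ≈ y) → guard b x ≈ guard b y
  guard-cong true eq = eq ≡.refl
  guard-cong false eq = refl

  ≡ᵇ-true⇒≡ : ∀ m n → (m ≡ᵇ n) ≡ true → m ≡ n
  ≡ᵇ-true⇒≡ m n eq = ℕP.≡ᵇ⇒≡ m n (≡.subst T (≡.sym eq) _)

  guard-≡ᵇ-cong : ∀ m n {x y} → (m ≡ n → x ≈ y) → guard (m ≡ᵇ n) x ≈ guard (m ≡ᵇ n) y
  guard-≡ᵇ-cong m n eq = guard-cong (m ≡ᵇ n) (λ b → eq (≡ᵇ-true⇒≡ m n b))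

  guard-* : ∀ b c x → guard b (c * x) ≈ c * guard b x
  guard-* true c x = refl
  guard-* false c x = sym (zeroʳ c)

  guard-+* : ∀ b x c y → guard b (x + c * y) ≈ guard b x + c * guard b y
  guard-+* true x c y = refl
  guard-+* false x c y = sym (trans (+-identityˡ _) (zeroʳ c))

  guard-comm : ∀ b c x → guard b (guard c x) ≈ guard c (guard b x)
  guard-comm true c x = refl
  guard-comm false true x = refl
  guard-comm false false x = refl

  guard-Σ : ∀ b m (f : Fin m → Carrier) → guard b (Σfin m f) ≈ Σfin m (λ i → guard b (f i))
  guard-Σ true m f = refl
  guard-Σ false m f = sym (Σ-zero m (λ i → refl))

  ΣSub-cong : ∀ n {f g : Subset n → Carrier} → (∀ τ → f τ ≈ g τ) → ΣSub n f ≈ ΣSub n g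
  ΣSub-cong zero eq = eq []
  ΣSub-cong (suc n) eq = +-cong (ΣSub-cong n (λ p → eq (false ∷ p))) (ΣSub-cong n (λ p → eq (true ∷ p)))

  ΣSub-zero : ∀ n {f : Subset n → Carrier} → (∀ τ → f τ ≈ 0#) → ΣSub n f ≈ 0#
  ΣSub-zero zero eq = eq []
  ΣSub-zero (suc n) eq =
    trans (+-cong (ΣSub-zero n (λ p → eq (false ∷ p))) (ΣSub-zero n (λ p → eq (true ∷ p)))) (+-identityˡ 0#)

  ΣSub-*ˡ : ∀ n c (f : Subset n → Carrier) → c * ΣSub n f ≈ ΣSub n (λ τ → c * f τ)
  ΣSub-*ˡ zero c f = refl
  ΣSub-*ˡ (suc n) c f = trans (distribˡ c _ _) (+-cong (ΣSub-*ˡ n c _) (ΣSub-*ˡ n c _))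

  ΣSub-Σ : ∀ n m (f : Subset n → Fin m → Carrier) →
    ΣSub n (λ τ → Σfin m (f τ)) ≈ Σfin m (λ i → ΣSub n (λ τ → f τ i))
  ΣSub-Σ zero m f = refl
  ΣSub-Σ (suc n) m f =
    trans (+-cong (ΣSub-Σ n m _) (ΣSub-Σ n m _)) (sym (Σ-+ m _ _))

  -- Subsets containing i correspond to subsets of the remaining n points.
  insert : ∀ {n} → Fin (suc n) → Subset n → Subset (suc n)
  insert zero p = true ∷ p
  insert (suc i) (b ∷ p) = b ∷ insert i p

  lookup-insert : ∀ {n} (i : Fin (suc n)) p → lookup (insert i p) i ≡ true
  lookup-insert zero p = ≡.refl
  lookup-insert (suc i) (b ∷ p) = lookup-insert i p

  lookup-insert-punchIn : ∀ {n} (i : Fin (suc n)) p l → lookup (insert i p) (punchIn i l) ≡ lookup p l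
  lookup-insert-punchIn zero p l = ≡.refl
  lookup-insert-punchIn (suc i) (b ∷ p) zero = ≡.refl
  lookup-insert-punchIn (suc i) (b ∷ p) (suc l) = lookup-insert-punchIn i p l

  ∣insert∣ : ∀ {n} (i : Fin (suc n)) p → ∣ insert i p ∣ ≡ suc ∣ p ∣
  ∣insert∣ zero p = ≡.refl
  ∣insert∣ (suc i) (true ∷ p) = ≡.cong suc (∣insert∣ i p)
  ∣insert∣ (suc i) (false ∷ p) = ∣insert∣ i p

  ∣p∣≤n : ∀ {n} (p : Subset n) → ∣ p ∣ ≤ n
  ∣p∣≤n [] = z≤n
  ∣p∣≤n (true ∷ p) = s≤s (∣p∣≤n p)
  ∣p∣≤n (false ∷ p) = ℕP.m≤n⇒m≤1+n (∣p∣≤n p)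

  ΣSub-insert : ∀ n (i : Fin (suc n)) (G : Subset (suc n) → Carrier) →
    ΣSub (suc n) (λ τ → guard (lookup τ i) (G τ)) ≈ ΣSub n (λ p → G (insert i p))
  ΣSub-insert n zero G = trans (+-cong (ΣSub-zero n (λ p → refl)) refl) (+-identityˡ _)
  ΣSub-insert (suc n) (suc i) G =
    +-cong (ΣSub-insert n i (λ p → G (false ∷ p))) (ΣSub-insert n i (λ p → G (true ∷ p)))

  ΣSubCard-zero : ∀ n (f : Subset n → Carrier) → ΣSubCard n 0 f ≈ f (replicate n false)
  ΣSubCard-zero zero f = refl
  ΣSubCard-zero (suc n) f =
    trans (+-cong (ΣSubCard-zero n (λ p → f (false ∷ p))) (ΣSub-zero n (λ p → refl))) (+-identityʳ _)

  Πin-cong : ∀ {n} (τ : Subset n) {f g : Fin n → Carrier} →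
    (∀ i → lookup τ i ≡ true → f i ≈ g i) → Πin τ f ≈ Πin τ g
  Πin-cong {n} τ {f} {g} eq = Π-cong n factor
    where
    factor : ∀ i → (if lookup τ i then f i else 1#) ≈ (if lookup τ i then g i else 1#)
    factor i with lookup τ i in e
    ... | true = eq i e
    ... | false = refl

  Πout-cong : ∀ {n} (τ : Subset n) {f g : Fin n → Carrier} →
    (∀ i → lookup τ i ≡ false → f i ≈ g i) → Πout τ f ≈ Πout τ g
  Πout-cong {n} τ {f} {g} eq = Π-cong n factor
    where
    factor : ∀ i → (if lookup τ i then 1# else f i) ≈ (if lookup τ i then 1# else g i)
    factor i with lookup τ i in e
    ... | true = refl
    ... | false = eq i e

  Πin-empty : ∀ n (f : Fin n → Carrier) → Πin (replicate n false) f ≈ 1#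
  Πin-empty zero f = refl
  Πin-empty (suc n) f = trans (*-identityˡ _) (Πin-empty n _)

  Πin-insert : ∀ n (i : Fin (suc n)) p (f : Fin (suc n) → Carrier) →
    Πin (insert i p) f ≈ f i * Πin p (λ l → f (punchIn i l))
  Πin-insert n i p f = trans (Π-punchIn n i (λ l → if lookup (insert i p) l then f l else 1#))
    (*-cong (reflexive (≡.cong (λ b → if b then f i else 1#) (lookup-insert i p)))
            (Π-cong n (λ l → reflexive (≡.cong (λ b → if b then f (punchIn i l) else 1#) (lookup-insert-punchIn i p l)))))

  Πout-insert : ∀ n (i : Fin (suc n)) p (f : Fin (suc n) → Carrier) →
    Πout (insert i p) f ≈ Πout p (λ l → f (punchIn i l))
  Πout-insert n i p f = trans (Π-punchIn n i (λ l → if lookup (insert i p) l then 1# else f l))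
    (trans (*-cong (reflexive (≡.cong (λ b → if b then 1# else f i) (lookup-insert i p)))
                   (Π-cong n (λ l → reflexive (≡.cong (λ b → if b then 1# else f (punchIn i l)) (lookup-insert-punchIn i p l)))))
           (*-identityˡ _))

  Π-in·out : ∀ {n} (p : Subset n) (f : Fin n → Carrier) → Πfin n f ≈ Πin p f * Πout p f
  Π-in·out {n} p f = trans (Π-cong n (λ i → factor (lookup p i) (f i))) (Π-* n _ _)
    where
    factor : ∀ b x → x ≈ (if b then x else 1#) * (if b then 1# else x)
    factor true x = sym (*-identityʳ x)
    factor false x = sym (*-identityˡ x)

  Πin-* : ∀ {n} (p : Subset n) (f g : Fin n → Carrier) → Πin p (λ j → f j * g j) ≈ Πin p f * Πin p g
  Πin-* {n} p f g = trans (Π-cong n (λ i → factor (lookup p i))) (Π-* n _ _)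
    where
    factor : ∀ b {x y} → (if b then x * y else 1#) ≈ (if b then x else 1#) * (if b then y else 1#)
    factor true = refl
    factor false = sym (*-identityˡ 1#)

  Πout-* : ∀ {n} (p : Subset n) (f g : Fin n → Carrier) → Πout p (λ j → f j * g j) ≈ Πout p f * Πout p g
  Πout-* {n} p f g = trans (Π-cong n (λ i → factor (lookup p i))) (Π-* n _ _)
    where
    factor : ∀ b {x y} → (if b then 1# else x * y) ≈ (if b then 1# else x) * (if b then 1# else y)
    factor true = sym (*-identityˡ 1#)
    factor false = refl

  Πin-const : ∀ {n} (p : Subset n) z → Πin p (λ _ → z) ≈ pow z ∣ p ∣
  Πin-const [] z = refl
  Πin-const (true ∷ p) z = *-cong refl (Πin-const p z)
  Πin-const (false ∷ p) z = trans (*-identityˡ _) (Πin-const p z)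

  Πout-const : ∀ {n} (p : Subset n) z → Πout p (λ _ → z) ≈ pow z (n ∸ ∣ p ∣)
  Πout-const [] z = refl
  Πout-const (true ∷ p) z = trans (*-identityˡ _) (Πout-const p z)
  Πout-const {suc n} (false ∷ p) z = trans (*-cong refl (Πout-const p z))
    (reflexive (≡.cong (pow z) (≡.sym (ℕP.+-∸-assoc 1 (∣p∣≤n p)))))

  e-zero-step : ∀ n (x : Fin (suc n) → Carrier) → e 0 x ≈ e 0 (λ i → x (suc i))
  e-zero-step n x = trans (+-cong (ΣSub-cong n (λ p → guard-cong (∣ p ∣ ≡ᵇ 0) (λ _ → *-identityˡ _)))
                                  (ΣSub-zero n (λ p → refl)))
                          (+-identityʳ _)

  e-suc-step : ∀ n m (x : Fin (suc n) → Carrier) →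
    e (suc m) x ≈ e (suc m) (λ i → x (suc i)) + x zero * e m (λ i → x (suc i))
  e-suc-step n m x =
    +-cong (ΣSub-cong n (λ p → guard-cong (∣ p ∣ ≡ᵇ suc m) (λ _ → *-identityˡ _)))
           (trans (ΣSub-cong n (λ p → guard-* (∣ p ∣ ≡ᵇ m) (x zero) _)) (sym (ΣSub-*ˡ n (x zero) _)))

  e-zero : ∀ n (x : Fin n → Carrier) → e 0 x ≈ 1#
  e-zero zero x = refl
  e-zero (suc n) x = trans (e-zero-step n x) (e-zero n _)

  e-beyond : ∀ n m (x : Fin n → Carrier) → n < m → e m x ≈ 0#
  e-beyond zero (suc m) x lt = refl
  e-beyond (suc n) (suc m) x (s≤s lt) = trans (e-suc-step n m x)
    (trans (+-cong (e-beyond n (suc m) _ (ℕP.m<n⇒m<1+n lt)) (trans (*-cong refl (e-beyond n m _ lt)) (zeroʳ _)))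
           (+-identityˡ 0#))

  -- The polynomial Σ_{m<M} e_m(x) t^{M-1-m}.  For M > n it equals
  -- t^{M-1-n} Π_l (t + x_l), so it vanishes at every t = -x_i.
  eSum : ∀ {n} → (Fin n → Carrier) → Carrier → ℕ → Carrier
  eSum x t M = Σfin M (λ m → e (toℕ m) x * pow t (M ∸ suc (toℕ m)))

  eSum-step : ∀ n (x : Fin (suc n) → Carrier) t M →
    eSum x t (suc M) ≈ eSum (λ i → x (suc i)) t (suc M) + x zero * eSum (λ i → x (suc i)) t M
  eSum-step n x t M = begin
    e 0 x * pow t M + Σfin M (λ m → e (suc (toℕ m)) x * term m)
      ≈⟨ +-cong (*-cong (e-zero-step n x) refl) (Σ-cong M (λ m → *-cong (e-suc-step n (toℕ m) x) refl)) ⟩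
    e 0 x' * pow t M + Σfin M (λ m → (e (suc (toℕ m)) x' + x zero * e (toℕ m) x') * term m)
      ≈⟨ +-cong refl (Σ-cong M (λ m → trans (distribʳ _ _ _) (+-cong refl (*-assoc _ _ _)))) ⟩
    e 0 x' * pow t M + Σfin M (λ m → e (suc (toℕ m)) x' * term m + x zero * (e (toℕ m) x' * term m))
      ≈⟨ +-cong refl (trans (Σ-+ M _ _) (+-cong refl (sym (Σ-*ˡ M (x zero) _)))) ⟩
    e 0 x' * pow t M + (Σfin M (λ m → e (suc (toℕ m)) x' * term m) + x zero * eSum x' t M)
      ≈⟨ +-assoc _ _ _ ⟨
    eSum x' t (suc M) + x zero * eSum x' t M ∎
    where
    x' : Fin n → Carrier
    x' i = x (suc i)
    term : Fin M → Carrier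
    term m = pow t (M ∸ suc (toℕ m))

  eSum-factor : ∀ n (x : Fin n → Carrier) t M → n < M →
    eSum x t M ≈ pow t (M ∸ suc n) * Πfin n (λ l → t + x l)
  eSum-factor zero x t (suc M) lt = begin
    1# * pow t M + Σfin M (λ m → 0# * pow t (M ∸ suc (toℕ m)))
      ≈⟨ +-cong (*-identityˡ _) (Σ-zero M (λ m → zeroˡ _)) ⟩
    pow t M + 0#
      ≈⟨ trans (+-identityʳ _) (sym (*-identityʳ _)) ⟩
    pow t M * 1# ∎
  eSum-factor (suc n) x t (suc M) (s≤s lt) = begin
    eSum x t (suc M)
      ≈⟨ eSum-step n x t M ⟩
    eSum x' t (suc M) + x zero * eSum x' t M
      ≈⟨ +-cong (eSum-factor n x' t (suc M) (ℕP.m<n⇒m<1+n lt)) (*-cong refl (eSum-factor n x' t M lt)) ⟩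
    pow t (M ∸ n) * P + x zero * (pow t (M ∸ suc n) * P)
      ≡⟨ ≡.cong (λ d → pow t d * P + x zero * (pow t (M ∸ suc n) * P)) (ℕP.+-∸-assoc 1 lt) ⟩
    (t * pow t (M ∸ suc n)) * P + x zero * (pow t (M ∸ suc n) * P)
      ≈⟨ solve 4 (λ t x p q → (t :* p) :* q :+ x :* (p :* q) := p :* ((t :+ x) :* q)) refl t (x zero) _ _ ⟩
    pow t (M ∸ suc n) * ((t + x zero) * P) ∎
    where
    x' : Fin n → Carrier
    x' i = x (suc i)
    P : Carrier
    P = Πfin n (λ l → t + x' l)

  eSum-root : ∀ n (x : Fin n → Carrier) (i : Fin n) M → n < M → eSum x (- x i) M ≈ 0#
  eSum-root n x i M lt =
    trans (eSum-factor n x (- x i) M lt) (trans (*-cong refl (Π-zero n i _ (-‿inverseˡ (x i)))) (zeroʳ _))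

  Distinct : ∀ {n} → (Fin n → Carrier) → Set ℓ
  Distinct {n} y = ∀ (i j : Fin n) → i ≢ j → ¬ (y i ≈ y j)

  Distinct-punchIn : ∀ {n} (y : Fin (suc n) → Carrier) → Distinct y → ∀ i → Distinct (λ l → y (punchIn i l))
  Distinct-punchIn y d i a b a≢b = d (punchIn i a) (punchIn i b) (λ e → a≢b (FinP.punchIn-injective i a b e))

  vandermonde : ∀ n → (Fin n → Carrier) → Carrier
  vandermonde n y = det n (λ i j → pow (y i) (n ∸ suc (toℕ j)))

  vandermondeProduct : ∀ n → (Fin n → Carrier) → Carrier
  vandermondeProduct zero y = 1#
  vandermondeProduct (suc n) y = Πfin n (λ l → y zero - y (suc l)) * vandermondeProduct n (λ i → y (suc i))

  -- Column operations turn column 0 into (Π_l (y_i - y_{l+1}))_i, which vanishes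
  -- except in row 0; expanding along column 0 leaves one Vandermonde minor.
  vandermonde-step : ∀ n (y : Fin (suc n) → Carrier) →
    vandermonde (suc n) y ≈ Πfin n (λ l → y zero - y (suc l)) * vandermonde n (λ i → y (suc i))
  vandermonde-step n y = begin
    vandermonde (suc n) y
      ≈⟨ det-addColumns₀ n n M M' (λ l → e (suc (toℕ l)) x') (λ l → l) column₀ (λ r j → refl) ⟨
    det (suc n) M'
      ≈⟨ det-expandColumn₀ n M' ⟩
    sign 0 * (M' zero zero * vandermonde n (λ i → y (suc i))) + Σfin n (λ r → sign (toℕ (suc r)) * (M' (suc r) zero * _))
      ≈⟨ +-cong (*-identityˡ _) (Σ-zero n (λ r → trans (*-cong refl (trans (*-cong (Π-zero n r _ (-‿inverseʳ (y (suc r)))) refl) (zeroˡ _))) (zeroʳ _))) ⟩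
    Πfin n (λ l → y zero - y (suc l)) * vandermonde n (λ i → y (suc i)) + 0#
      ≈⟨ +-identityʳ _ ⟩
    Πfin n (λ l → y zero - y (suc l)) * vandermonde n (λ i → y (suc i)) ∎
    where
    x' : Fin n → Carrier
    x' l = - y (suc l)
    M M' : Matrix (suc n)
    M i j = pow (y i) (suc n ∸ suc (toℕ j))
    M' i zero = Πfin n (λ l → y i - y (suc l))
    M' i (suc j) = M i (suc j)
    column₀ : ∀ r → M' r zero ≈ M r zero + Σfin n (λ l → e (suc (toℕ l)) x' * M r (suc l))
    column₀ r = begin
      Πfin n (λ l → y r - y (suc l))
        ≈⟨ *-identityˡ _ ⟨
      1# * Πfin n (λ l → y r + x' l)
        ≡⟨ ≡.cong (λ d → pow (y r) d * Πfin n (λ l → y r + x' l)) (ℕP.n∸n≡0 n) ⟨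
      pow (y r) (n ∸ n) * Πfin n (λ l → y r + x' l)
        ≈⟨ eSum-factor n x' (y r) (suc n) (ℕP.n<1+n n) ⟨
      e 0 x' * pow (y r) n + Σfin n (λ l → e (suc (toℕ l)) x' * pow (y r) (n ∸ suc (toℕ l)))
        ≈⟨ +-cong (trans (*-cong (e-zero n x') refl) (*-identityˡ _)) refl ⟩
      M r zero + Σfin n (λ l → e (suc (toℕ l)) x' * M r (suc l)) ∎

  vandermonde≈product : ∀ n y → vandermonde n y ≈ vandermondeProduct n y
  vandermonde≈product zero y = refl
  vandermonde≈product (suc n) y = trans (vandermonde-step n y) (*-cong refl (vandermonde≈product n _))

  vandermonde-nonzero : ∀ n (y : Fin n → Carrier) → Distinct y → ¬ (vandermonde n y ≈ 0#)
  vandermonde-nonzero n y d V≈0 = product-nonzero n y d (trans (sym (vandermonde≈product n y)) V≈0)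
    where
    product-nonzero : ∀ n (y : Fin n → Carrier) → Distinct y → ¬ (vandermondeProduct n y ≈ 0#)
    product-nonzero zero y d = 1≉0
    product-nonzero (suc n) y d = *-nonzero
      (Π-nonzero n _ (λ l → difference-nonzero (d zero (suc l) (λ ()))))
      (product-nonzero n _ (Distinct-punchIn y d zero))

  differences : ∀ n → (Fin (suc n) → Carrier) → Fin (suc n) → Carrier
  differences n y i = Πfin n (λ l → y i - y (punchIn i l))

  inverseDifferences : ∀ n → (Fin (suc n) → Carrier) → Fin (suc n) → Carrier
  inverseDifferences n y i = Πfin n (λ l → (y i - y (punchIn i l)) ⁻¹)

  vandermondeProduct-remove : ∀ n (y : Fin (suc n) → Carrier) (i : Fin (suc n)) →
    vandermondeProduct (suc n) y ≈ sign (toℕ i) * (differences n y i * vandermondeProduct n (λ l → y (punchIn i l)))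
  vandermondeProduct-remove n y zero = sym (*-identityˡ _)
  vandermondeProduct-remove (suc n) y (suc i) = begin
    Πfin (suc n) (λ l → y zero - y (suc l)) * vandermondeProduct (suc n) (λ l → y (suc l))
      ≈⟨ *-cong (Π-punchIn n i (λ l → y zero - y (suc l))) (vandermondeProduct-remove n (λ l → y (suc l)) i) ⟩
    ((y zero - y (suc i)) * P) * (sign (toℕ i) * (Q * W))
      ≈⟨ *-cong (*-cong (⁻¹-anti-homo‿- (y (suc i)) (y zero)) refl) refl ⟨
    ((- (y (suc i) - y zero)) * P) * (sign (toℕ i) * (Q * W))
      ≈⟨ trans (-‿distribˡ-* _ _) (*-cong (-‿distribˡ-* _ _) refl) ⟨
    - (((y (suc i) - y zero) * P) * (sign (toℕ i) * (Q * W)))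
      ≈⟨ -‿cong (solve 5 (λ d p s q w → (d :* p) :* (s :* (q :* w)) := s :* ((d :* q) :* (p :* w))) refl _ _ _ _ _) ⟩
    - (sign (toℕ i) * (((y (suc i) - y zero) * Q) * (P * W)))
      ≈⟨ -‿distribˡ-* _ _ ⟩
    (- sign (toℕ i)) * (((y (suc i) - y zero) * Q) * (P * W)) ∎
    where
    P Q W : Carrier
    P = Πfin n (λ l → y zero - y (suc (punchIn i l)))
    Q = differences n (λ l → y (suc l)) i
    W = vandermondeProduct n (λ l → y (suc (punchIn i l)))

  vandermonde-remove : ∀ n (y : Fin (suc n) → Carrier) → Distinct y → ∀ i →
    vandermonde n (λ l → y (punchIn i l)) ≈ sign (toℕ i) * (inverseDifferences n y i * vandermonde (suc n) y)
  vandermonde-remove n y d i = sym (begin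
    sign (toℕ i) * (inverseDifferences n y i * vandermonde (suc n) y)
      ≈⟨ *-cong refl (*-cong refl (trans (vandermonde≈product (suc n) y) (vandermondeProduct-remove n y i))) ⟩
    sign (toℕ i) * (inverseDifferences n y i * (sign (toℕ i) * (differences n y i * vandermondeProduct n y')))
      ≈⟨ solve 4 (λ s a q v → s :* (a :* (s :* (q :* v))) := (s :* s) :* ((q :* a) :* v)) refl _ _ _ _ ⟩
    (sign (toℕ i) * sign (toℕ i)) * ((differences n y i * inverseDifferences n y i) * vandermondeProduct n y')
      ≈⟨ *-cong (sign-sq (toℕ i)) (*-cong (Π-inverse n _ differences-nonzero) refl) ⟩
    1# * (1# * vandermondeProduct n y')
      ≈⟨ trans (*-identityˡ _) (*-identityˡ _) ⟩
    vandermondeProduct n y'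
      ≈⟨ vandermonde≈product n y' ⟨
    vandermonde n y' ∎)
    where
    y' : Fin n → Carrier
    y' l = y (punchIn i l)
    differences-nonzero : ∀ l → ¬ (y i - y (punchIn i l) ≈ 0#)
    differences-nonzero l = difference-nonzero (d i (punchIn i l) (λ e → FinP.punchInᵢ≢i i l (≡.sym e)))

  -- The Lagrange interpolation identity: for distinct points and a nonempty
  -- τ ⊆ [n+1],
  --   Σ_{i∈τ} y_i^m Π_{j∈τ, j≠i} (y_i - y_j)⁻¹ = 1 if m = |τ|-1, and 0 if m < |τ|-1.
  -- It is proved by induction on τ: a leading point outside τ is dropped, the
  -- exponent is raised by the recurrence of lagrangeSum-raise, and for m = 0
  -- the first two points are exchanged.

  lagrangeWeight : ∀ n → (Fin (suc n) → Carrier) → Subset (suc n) → Fin (suc n) → Carrier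
  lagrangeWeight n y τ i = Πfin n (λ l → if lookup τ (punchIn i l) then (y i - y (punchIn i l)) ⁻¹ else 1#)

  lagrangeSum : ∀ n → (Fin (suc n) → Carrier) → Subset (suc n) → ℕ → Carrier
  lagrangeSum n y τ m = Σfin (suc n) (λ i → guard (lookup τ i) (pow (y i) m * lagrangeWeight n y τ i))

  lagrangeSum-drop : ∀ n (y : Fin (suc (suc n)) → Carrier) τ m →
    lagrangeSum (suc n) y (false ∷ τ) m ≈ lagrangeSum n (λ i → y (suc i)) τ m
  lagrangeSum-drop n y τ m = trans (+-identityˡ _) (Σ-cong (suc n) (λ i →
    guard-cong (lookup τ i) (λ _ → *-cong (refl {pow (y (suc i)) m}) (*-identityˡ (lagrangeWeight n (λ l → y (suc l)) τ i)))))

  -- With y₀ ∈ τ: y_i = (y_i - y₀) + y₀ splits each term of exponent m+1.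
  lagrangeSum-raise : ∀ n (y : Fin (suc (suc n)) → Carrier) → Distinct y → ∀ τ m →
    lagrangeSum (suc n) y (true ∷ τ) (suc m) ≈ y zero * lagrangeSum (suc n) y (true ∷ τ) m + lagrangeSum n (λ i → y (suc i)) τ m
  lagrangeSum-raise n y d τ m = begin
    (y zero * pow (y zero) m) * W₀ + Σfin (suc n) old
      ≈⟨ +-cong (*-assoc _ _ _) (Σ-cong (suc n) (λ i → trans (guard-cong (lookup τ i) (λ _ → split i)) (guard-+* (lookup τ i) _ (y zero) _))) ⟩
    y zero * (pow (y zero) m * W₀) + Σfin (suc n) (λ i → dropped i + y zero * lowered i)
      ≈⟨ +-cong refl (trans (Σ-+ (suc n) dropped (λ i → y zero * lowered i)) (+-cong refl (sym (Σ-*ˡ (suc n) (y zero) lowered)))) ⟩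
    y zero * (pow (y zero) m * W₀) + (Σfin (suc n) dropped + y zero * Σfin (suc n) lowered)
      ≈⟨ solve 4 (λ y a g b → y :* a :+ (g :+ y :* b) := y :* (a :+ b) :+ g) refl (y zero) _ _ _ ⟩
    y zero * lagrangeSum (suc n) y (true ∷ τ) m + lagrangeSum n (λ i → y (suc i)) τ m ∎
    where
    W₀ : Carrier
    W₀ = lagrangeWeight (suc n) y (true ∷ τ) zero
    I W : Fin (suc n) → Carrier
    I i = (y (suc i) - y zero) ⁻¹
    W i = lagrangeWeight n (λ l → y (suc l)) τ i
    old dropped lowered : Fin (suc n) → Carrier
    old i = guard (lookup τ i) ((y (suc i) * pow (y (suc i)) m) * (I i * W i))
    dropped i = guard (lookup τ i) (pow (y (suc i)) m * W i)
    lowered i = guard (lookup τ i) (pow (y (suc i)) m * (I i * W i))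
    yI : ∀ i → y (suc i) * I i ≈ 1# + y zero * I i
    yI i = begin
      y (suc i) * I i
        ≈⟨ *-cong (trans (+-assoc _ _ _) (trans (+-cong refl (-‿inverseˡ _)) (+-identityʳ _))) refl ⟨
      ((y (suc i) - y zero) + y zero) * I i
        ≈⟨ distribʳ _ _ _ ⟩
      (y (suc i) - y zero) * I i + y zero * I i
        ≈⟨ +-cong (⁻¹-inverse _ (difference-nonzero (d (suc i) zero (λ ())))) refl ⟩
      1# + y zero * I i ∎
    split : ∀ i → (y (suc i) * pow (y (suc i)) m) * (I i * W i) ≈ pow (y (suc i)) m * W i + y zero * (pow (y (suc i)) m * (I i * W i))
    split i = begin
      (y (suc i) * pow (y (suc i)) m) * (I i * W i)
        ≈⟨ solve 4 (λ a p q r → (a :* p) :* (q :* r) := (a :* q) :* (p :* r)) refl _ _ _ _ ⟩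
      (y (suc i) * I i) * (pow (y (suc i)) m * W i)
        ≈⟨ *-cong (yI i) refl ⟩
      (1# + y zero * I i) * (pow (y (suc i)) m * W i)
        ≈⟨ trans (distribʳ _ _ _) (+-cong (*-identityˡ _) (solve 4 (λ a q p r → (a :* q) :* (p :* r) := a :* (p :* (q :* r))) refl _ _ _ _)) ⟩
      pow (y (suc i)) m * W i + y zero * (pow (y (suc i)) m * (I i * W i)) ∎

  swap₀₁ : ∀ {n} → Fin (suc (suc n)) → Fin (suc (suc n))
  swap₀₁ zero = suc zero
  swap₀₁ (suc zero) = zero
  swap₀₁ (suc (suc j)) = suc (suc j)

  swap₀₁-injective : ∀ {n} (i j : Fin (suc (suc n))) → swap₀₁ i ≡ swap₀₁ j → i ≡ j
  swap₀₁-injective zero zero e = ≡.refl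
  swap₀₁-injective zero (suc zero) ()
  swap₀₁-injective zero (suc (suc j)) ()
  swap₀₁-injective (suc zero) zero ()
  swap₀₁-injective (suc zero) (suc zero) e = ≡.refl
  swap₀₁-injective (suc zero) (suc (suc j)) ()
  swap₀₁-injective (suc (suc i)) zero ()
  swap₀₁-injective (suc (suc i)) (suc zero) ()
  swap₀₁-injective (suc (suc i)) (suc (suc j)) e = e

  Distinct-swap₀₁ : ∀ {n} (y : Fin (suc (suc n)) → Carrier) → Distinct y → Distinct (λ i → y (swap₀₁ i))
  Distinct-swap₀₁ y d i j i≢j = d (swap₀₁ i) (swap₀₁ j) (λ e → i≢j (swap₀₁-injective i j e))

  -- Exchanging the first two points only permutes the factors of the other weights.
  lagrangeWeight-swap : ∀ n (y : Fin (suc (suc n)) → Carrier) a b τ (j : Fin n) →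
    lagrangeWeight (suc n) (λ i → y (swap₀₁ i)) (b ∷ a ∷ τ) (suc (suc j)) ≈ lagrangeWeight (suc n) y (a ∷ b ∷ τ) (suc (suc j))
  lagrangeWeight-swap (suc n) y a b τ j = solve 3 (λ p q r → p :* (q :* r) := q :* (p :* r)) refl _ _ _

  lagrangeSum-swap : ∀ n (y : Fin (suc (suc n)) → Carrier) a b τ m →
    lagrangeSum (suc n) (λ i → y (swap₀₁ i)) (b ∷ a ∷ τ) m ≈ lagrangeSum (suc n) y (a ∷ b ∷ τ) m
  lagrangeSum-swap n y a b τ m =
    trans (+-cong refl (+-cong refl (Σ-cong n (λ j → guard-cong (lookup τ j) (λ _ → *-cong refl (lagrangeWeight-swap n y a b τ j))))))
          (solve 3 (λ p q r → p :+ (q :+ r) := q :+ (p :+ r)) refl _ _ _)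

  LagrangeIdentity : ∀ n → (Fin (suc n) → Carrier) → Subset (suc n) → ℕ → Set ℓ
  LagrangeIdentity n y τ m =
    (∣ τ ∣ ≡ suc m → lagrangeSum n y τ m ≈ 1#) × (suc m < ∣ τ ∣ → lagrangeSum n y τ m ≈ 0#)

  lagrange-drop : ∀ n (y : Fin (suc (suc n)) → Carrier) τ m →
    LagrangeIdentity n (λ i → y (suc i)) τ m → LagrangeIdentity (suc n) y (false ∷ τ) m
  lagrange-drop n y τ m (one , zero′) =
    (λ e → trans (lagrangeSum-drop n y τ m) (one e)) , (λ lt → trans (lagrangeSum-drop n y τ m) (zero′ lt))

  lagrange-raise : ∀ n (y : Fin (suc (suc n)) → Carrier) → Distinct y → ∀ τ m →
    LagrangeIdentity (suc n) y (true ∷ τ) m → LagrangeIdentity n (λ i → y (suc i)) τ m →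
    LagrangeIdentity (suc n) y (true ∷ τ) (suc m)
  lagrange-raise n y d τ m (_ , zeroτ) (oneτ' , zeroτ') = one , zero′
    where
    one : ∣ true ∷ τ ∣ ≡ suc (suc m) → lagrangeSum (suc n) y (true ∷ τ) (suc m) ≈ 1#
    one e = trans (lagrangeSum-raise n y d τ m)
      (trans (+-cong (trans (*-cong refl (zeroτ (s≤s (ℕP.≤-reflexive (≡.sym (ℕP.suc-injective e)))))) (zeroʳ _))
                     (oneτ' (ℕP.suc-injective e)))
             (+-identityˡ _))
    zero′ : suc (suc m) < ∣ true ∷ τ ∣ → lagrangeSum (suc n) y (true ∷ τ) (suc m) ≈ 0#
    zero′ (s≤s lt) = trans (lagrangeSum-raise n y d τ m)
      (trans (+-cong (trans (*-cong refl (zeroτ (ℕP.m<n⇒m<1+n lt))) (zeroʳ _)) (zeroτ' lt))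
             (+-identityˡ _))

  -- Exponent 0 with y₁ ∉ τ: exchange y₀ and y₁, then drop the leading point.
  lagrange-swapDrop : ∀ n (y : Fin (suc (suc n)) → Carrier) τ →
    LagrangeIdentity n (λ i → y (swap₀₁ (suc i))) (true ∷ τ) zero →
    LagrangeIdentity (suc n) y (true ∷ false ∷ τ) zero
  lagrange-swapDrop n y τ (one , zero′) = (λ e → trans reduce (one e)) , (λ lt → trans reduce (zero′ lt))
    where
    reduce : lagrangeSum (suc n) y (true ∷ false ∷ τ) zero ≈ lagrangeSum n (λ i → y (swap₀₁ (suc i))) (true ∷ τ) zero
    reduce = trans (sym (lagrangeSum-swap n y true false τ zero)) (lagrangeSum-drop n (λ i → y (swap₀₁ i)) (true ∷ τ) zero)

  -- Exponent 0 with y₀, y₁ ∈ τ: raising the exponent in two ways gives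
  -- y₀ G + A = y₁ G + B where A = B by induction, so (y₀ - y₁) G = 0.
  lagrange-twoPoints : ∀ n (y : Fin (suc (suc n)) → Carrier) → Distinct y → ∀ τ →
    LagrangeIdentity n (λ i → y (suc i)) (true ∷ τ) zero →
    LagrangeIdentity n (λ i → y (swap₀₁ (suc i))) (true ∷ τ) zero →
    LagrangeIdentity (suc n) y (true ∷ true ∷ τ) zero
  lagrange-twoPoints n y d τ (oneA , zeroA) (oneB , zeroB) = (λ ()) , (λ _ → G≈0)
    where
    G A B : Carrier
    G = lagrangeSum (suc n) y (true ∷ true ∷ τ) zero
    A = lagrangeSum n (λ i → y (suc i)) (true ∷ τ) zero
    B = lagrangeSum n (λ i → y (swap₀₁ (suc i))) (true ∷ τ) zero
    A≈B : ∀ t → ∣ τ ∣ ≡ t → A ≈ B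
    A≈B zero eq = trans (oneA (≡.cong suc eq)) (sym (oneB (≡.cong suc eq)))
    A≈B (suc t) eq = trans (zeroA lt) (sym (zeroB lt))
      where
      lt : 1 < suc ∣ τ ∣
      lt = ≡.subst (λ z → 1 < suc z) (≡.sym eq) (s≤s (s≤s z≤n))
    viaY₀ : lagrangeSum (suc n) y (true ∷ true ∷ τ) 1 ≈ y zero * G + A
    viaY₀ = lagrangeSum-raise n y d (true ∷ τ) zero
    viaY₁ : lagrangeSum (suc n) y (true ∷ true ∷ τ) 1 ≈ y (suc zero) * G + B
    viaY₁ = trans (sym (lagrangeSum-swap n y true true τ 1))
             (trans (lagrangeSum-raise n (λ i → y (swap₀₁ i)) (Distinct-swap₀₁ y d) (true ∷ τ) zero)
                    (+-cong (*-cong refl (lagrangeSum-swap n y true true τ zero)) refl))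
    y₀G≈y₁G : y zero * G ≈ y (suc zero) * G
    y₀G≈y₁G = +-cancelʳ A _ _ (trans (sym viaY₀) (trans viaY₁ (+-cong refl (sym (A≈B ∣ τ ∣ ≡.refl)))))
    G≈0 : G ≈ 0#
    G≈0 = *-cancelˡ-nonzero (y zero - y (suc zero)) G 0# (difference-nonzero (d zero (suc zero) (λ ())))
      (begin
        (y zero - y (suc zero)) * G                    ≈⟨ distribʳ _ _ _ ⟩
        y zero * G + (- y (suc zero)) * G              ≈⟨ +-cong y₀G≈y₁G (sym (-‿distribˡ-* _ _)) ⟩
        y (suc zero) * G + - (y (suc zero) * G)        ≈⟨ -‿inverseʳ _ ⟩
        0#                                             ≈⟨ zeroʳ _ ⟨
        (y zero - y (suc zero)) * 0#                   ∎)

  lagrange-identity : ∀ n (y : Fin (suc n) → Carrier) → Distinct y → ∀ τ m → LagrangeIdentity n y τ m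
  lagrange-identity zero y d (false ∷ []) m = (λ ()) , (λ ())
  lagrange-identity zero y d (true ∷ []) zero = (λ _ → trans (+-identityʳ _) (*-identityˡ 1#)) , (λ { (s≤s ()) })
  lagrange-identity zero y d (true ∷ []) (suc m) = (λ ()) , (λ { (s≤s ()) })
  lagrange-identity (suc n) y d (false ∷ τ) m =
    lagrange-drop n y τ m (lagrange-identity n _ (Distinct-punchIn y d zero) τ m)
  lagrange-identity (suc n) y d (true ∷ τ) (suc m) =
    lagrange-raise n y d τ m (lagrange-identity (suc n) y d (true ∷ τ) m) (lagrange-identity n _ (Distinct-punchIn y d zero) τ m)
  lagrange-identity (suc n) y d (true ∷ false ∷ τ) zero =
    lagrange-swapDrop n y τ (lagrange-identity n _ (Distinct-punchIn _ (Distinct-swap₀₁ y d) zero) (true ∷ τ) zero)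
  lagrange-identity (suc n) y d (true ∷ true ∷ τ) zero =
    lagrange-twoPoints n y d τ (lagrange-identity n _ (Distinct-punchIn y d zero) (true ∷ τ) zero)
                               (lagrange-identity n _ (Distinct-punchIn _ (Distinct-swap₀₁ y d) zero) (true ∷ τ) zero)

  -- Proof by induction on c: expand along column 0, use vandermonde-remove on
  -- each minor, and recombine with the Lagrange identity.

  gvExponent : ℕ → ℕ → ℕ → ℕ → ℕ
  gvExponent n c k t = if t ℕ.<ᵇ c then (n ℕ.+ k) ∸ suc t else n ∸ suc t

  gvDet : ∀ n → (Fin n → Carrier) → ℕ → ℕ → Carrier
  gvDet n y c k = det n (λ i j → pow (y i) (gvExponent n c k (toℕ j)))

  subsetTerm : ∀ {n} → (Fin n → Carrier) → ℕ → Subset n → Carrier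
  subsetTerm y k τ = Πin τ (λ i → pow (y i) k) * Πin τ (λ i → Πout τ (λ j → y i / (y i - y j)))

  Ω : ∀ n → (Fin n → Carrier) → ℕ → ℕ → Carrier
  Ω n y c k = ΣSubCard n c (subsetTerm y k)

  subsetTerm-insert : ∀ n c k (y : Fin (suc n) → Carrier) (i : Fin (suc n)) (p : Subset n) → c ≤ n → ∣ p ∣ ≡ c →
    subsetTerm y k (insert i p) * (pow (y i) c * lagrangeWeight n y (insert i p) i)
    ≈ pow (y i) (n ℕ.+ k) * (inverseDifferences n y i * subsetTerm (λ l → y (punchIn i l)) k p)
  subsetTerm-insert n c k y i p c≤n ∣p∣≡c = begin
    subsetTerm y k (insert i p) * (pow (y i) c * lagrangeWeight n y (insert i p) i)
      ≈⟨ *-cong (*-cong powersIn (trans (Πin-insert n i p (λ l → Πout (insert i p) (ratio l))) (*-cong ratiosOfI ratiosOfOthers)))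
                (*-cong refl weight) ⟩
    (yk * Πk) * ((yo * Πo) * R) * (yc * Πi)
      ≈⟨ solve 7 (λ yk Πk yo Πo R yc Πi → (yk :* Πk) :* ((yo :* Πo) :* R) :* (yc :* Πi)
                   := (yk :* (yc :* yo)) :* ((Πi :* Πo) :* (Πk :* R))) refl yk Πk yo Πo R yc Πi ⟩
    (yk * (yc * yo)) * ((Πi * Πo) * (Πk * R))
      ≈⟨ *-cong (sym exponents) (*-cong (sym (Π-in·out p inv)) refl) ⟩
    pow (y i) (n ℕ.+ k) * (inverseDifferences n y i * subsetTerm (λ l → y (punchIn i l)) k p) ∎
    where
    ratio : Fin (suc n) → Fin (suc n) → Carrier
    ratio l j = y l / (y l - y j)
    inv : Fin n → Carrier
    inv l = (y i - y (punchIn i l)) ⁻¹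
    yk yc yo Πk Πo Πi R : Carrier
    yk = pow (y i) k
    yc = pow (y i) c
    yo = pow (y i) (n ∸ c)
    Πk = Πin p (λ l → pow (y (punchIn i l)) k)
    Πo = Πout p inv
    Πi = Πin p inv
    R = Πin p (λ l → Πout p (λ j → y (punchIn i l) / (y (punchIn i l) - y (punchIn i j))))
    powersIn : Πin (insert i p) (λ l → pow (y l) k) ≈ yk * Πk
    powersIn = Πin-insert n i p (λ l → pow (y l) k)
    ratiosOfI : Πout (insert i p) (ratio i) ≈ yo * Πo
    ratiosOfI = begin
      Πout (insert i p) (ratio i)         ≈⟨ Πout-insert n i p (ratio i) ⟩
      Πout p (λ j → y i * inv j)          ≈⟨ Πout-* p (λ _ → y i) inv ⟩
      Πout p (λ _ → y i) * Πo             ≈⟨ *-cong (Πout-const p (y i)) refl ⟩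
      pow (y i) (n ∸ ∣ p ∣) * Πo          ≡⟨ ≡.cong (λ z → pow (y i) (n ∸ z) * Πo) ∣p∣≡c ⟩
      yo * Πo                             ∎
    ratiosOfOthers : Πin p (λ l → Πout (insert i p) (ratio (punchIn i l))) ≈ R
    ratiosOfOthers = Πin-cong p (λ l _ → Πout-insert n i p (ratio (punchIn i l)))
    weight : lagrangeWeight n y (insert i p) i ≈ Πi
    weight = Π-cong n (λ l → reflexive (≡.cong (λ b → if b then inv l else 1#) (lookup-insert-punchIn i p l)))
    exponents : pow (y i) (n ℕ.+ k) ≈ yk * (yc * yo)
    exponents = begin
      pow (y i) (n ℕ.+ k)              ≡⟨ ≡.cong (pow (y i)) (ℕP.+-comm n k) ⟩
      pow (y i) (k ℕ.+ n)              ≈⟨ pow-+ (y i) k n ⟩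
      yk * pow (y i) n                 ≡⟨ ≡.cong (λ z → yk * pow (y i) z) (ℕP.m+[n∸m]≡n c≤n) ⟨
      yk * pow (y i) (c ℕ.+ (n ∸ c))   ≈⟨ *-cong refl (pow-+ (y i) c _) ⟩
      yk * (yc * yo)                   ∎

  pointedTerm : ∀ n → ℕ → ℕ → (Fin (suc n) → Carrier) → Fin (suc n) → Subset (suc n) → Carrier
  pointedTerm n c k y i τ = guard (∣ τ ∣ ≡ᵇ suc c) (subsetTerm y k τ * (pow (y i) c * lagrangeWeight n y τ i))

  -- For |τ| = c+1 the Lagrange sum is 1, so the term of τ splits into its
  -- pointed terms over i ∈ τ.
  subsetTerm-split : ∀ n c k (y : Fin (suc n) → Carrier) → Distinct y → ∀ τ →
    guard (∣ τ ∣ ≡ᵇ suc c) (subsetTerm y k τ) ≈ Σfin (suc n) (λ i → guard (lookup τ i) (pointedTerm n c k y i τ))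
  subsetTerm-split n c k y d τ = begin
    guard b (subsetTerm y k τ)
      ≈⟨ guard-≡ᵇ-cong ∣ τ ∣ (suc c) timesLagrangeSum ⟩
    guard b (subsetTerm y k τ * Σfin (suc n) (λ i → guard (lookup τ i) (weighted i)))
      ≈⟨ guard-cong b (λ _ → trans (Σ-*ˡ (suc n) (subsetTerm y k τ) (λ i → guard (lookup τ i) (weighted i)))
                                   (Σ-cong (suc n) (λ i → sym (guard-* (lookup τ i) (subsetTerm y k τ) (weighted i))))) ⟩
    guard b (Σfin (suc n) (λ i → guard (lookup τ i) (subsetTerm y k τ * weighted i)))
      ≈⟨ guard-Σ b (suc n) (λ i → guard (lookup τ i) (subsetTerm y k τ * weighted i)) ⟩
    Σfin (suc n) (λ i → guard b (guard (lookup τ i) (subsetTerm y k τ * weighted i)))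
      ≈⟨ Σ-cong (suc n) (λ i → guard-comm b (lookup τ i) (subsetTerm y k τ * weighted i)) ⟩
    Σfin (suc n) (λ i → guard (lookup τ i) (pointedTerm n c k y i τ)) ∎
    where
    b : Bool
    b = ∣ τ ∣ ≡ᵇ suc c
    weighted : Fin (suc n) → Carrier
    weighted i = pow (y i) c * lagrangeWeight n y τ i
    timesLagrangeSum : ∣ τ ∣ ≡ suc c → subsetTerm y k τ ≈ subsetTerm y k τ * lagrangeSum n y τ c
    timesLagrangeSum ∣τ∣≡ = sym (trans (*-cong refl (proj₁ (lagrange-identity n y d τ c) ∣τ∣≡)) (*-identityʳ _))

  pointedTerm-Σ : ∀ n c k (y : Fin (suc n) → Carrier) → c ≤ n → ∀ i →
    ΣSub n (λ p → pointedTerm n c k y i (insert i p))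
    ≈ pow (y i) (n ℕ.+ k) * (inverseDifferences n y i * Ω n (λ l → y (punchIn i l)) c k)
  pointedTerm-Σ n c k y c≤n i = begin
    ΣSub n (λ p → pointedTerm n c k y i (insert i p))
      ≈⟨ ΣSub-cong n atInsert ⟩
    ΣSub n (λ p → Y * (Q * guard (∣ p ∣ ≡ᵇ c) (subsetTerm y' k p)))
      ≈⟨ ΣSub-*ˡ n _ _ ⟨
    Y * ΣSub n (λ p → Q * guard (∣ p ∣ ≡ᵇ c) (subsetTerm y' k p))
      ≈⟨ *-cong refl (ΣSub-*ˡ n _ _) ⟨
    Y * (Q * Ω n y' c k) ∎
    where
    y' : Fin n → Carrier
    y' l = y (punchIn i l)
    Y Q : Carrier
    Y = pow (y i) (n ℕ.+ k)
    Q = inverseDifferences n y i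
    atInsert : ∀ p → pointedTerm n c k y i (insert i p) ≈ Y * (Q * guard (∣ p ∣ ≡ᵇ c) (subsetTerm y' k p))
    atInsert p = begin
      pointedTerm n c k y i (insert i p)
        ≡⟨ ≡.cong (λ z → guard (z ≡ᵇ suc c) (subsetTerm y k (insert i p) * (pow (y i) c * lagrangeWeight n y (insert i p) i))) (∣insert∣ i p) ⟩
      guard (∣ p ∣ ≡ᵇ c) (subsetTerm y k (insert i p) * (pow (y i) c * lagrangeWeight n y (insert i p) i))
        ≈⟨ guard-≡ᵇ-cong ∣ p ∣ c (subsetTerm-insert n c k y i p c≤n) ⟩
      guard (∣ p ∣ ≡ᵇ c) (Y * (Q * subsetTerm y' k p))
        ≈⟨ trans (guard-* (∣ p ∣ ≡ᵇ c) _ _) (*-cong refl (guard-* (∣ p ∣ ≡ᵇ c) _ _)) ⟩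
      Y * (Q * guard (∣ p ∣ ≡ᵇ c) (subsetTerm y' k p)) ∎

  Ω-regroup : ∀ n c k (y : Fin (suc n) → Carrier) → Distinct y → c ≤ n →
    Σfin (suc n) (λ i → pow (y i) (n ℕ.+ k) * (inverseDifferences n y i * Ω n (λ l → y (punchIn i l)) c k))
    ≈ Ω (suc n) y (suc c) k
  Ω-regroup n c k y d c≤n = sym (begin
    ΣSub (suc n) (λ τ → guard (∣ τ ∣ ≡ᵇ suc c) (subsetTerm y k τ))
      ≈⟨ ΣSub-cong (suc n) (subsetTerm-split n c k y d) ⟩
    ΣSub (suc n) (λ τ → Σfin (suc n) (λ i → guard (lookup τ i) (H i τ)))
      ≈⟨ ΣSub-Σ (suc n) (suc n) (λ τ i → guard (lookup τ i) (H i τ)) ⟩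
    Σfin (suc n) (λ i → ΣSub (suc n) (λ τ → guard (lookup τ i) (H i τ)))
      ≈⟨ Σ-cong (suc n) (λ i → ΣSub-insert n i (H i)) ⟩
    Σfin (suc n) (λ i → ΣSub n (λ p → H i (insert i p)))
      ≈⟨ Σ-cong (suc n) (pointedTerm-Σ n c k y c≤n) ⟩
    Σfin (suc n) (λ i → pow (y i) (n ℕ.+ k) * (inverseDifferences n y i * Ω n (λ l → y (punchIn i l)) c k)) ∎)
    where
    H : Fin (suc n) → Subset (suc n) → Carrier
    H = pointedTerm n c k y

  -- For c > 0, column 0 has exponent
  -- n+k and its minors are generalized Vandermonde determinants of the other
  -- points with c-1; vandermonde-remove and Ω-regroup reassemble the sum.
  generalizedVandermonde : ∀ n c k → c ≤ n → ∀ (y : Fin n → Carrier) → Distinct y →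
    gvDet n y c k ≈ vandermonde n y * Ω n y c k
  generalizedVandermonde n zero k c≤n y d = sym (begin
    vandermonde n y * Ω n y 0 k
      ≈⟨ *-cong refl (ΣSubCard-zero n (subsetTerm y k)) ⟩
    vandermonde n y * (Πin ∅ (λ i → pow (y i) k) * Πin ∅ (λ i → Πout ∅ (λ j → y i / (y i - y j))))
      ≈⟨ *-cong refl (trans (*-cong (Πin-empty n _) (Πin-empty n _)) (*-identityˡ 1#)) ⟩
    vandermonde n y * 1#
      ≈⟨ *-identityʳ _ ⟩
    vandermonde n y ∎)
    where
    ∅ : Subset n
    ∅ = replicate n false
  generalizedVandermonde (suc n) (suc c) k (s≤s c≤n) y d = begin
    gvDet (suc n) y (suc c) k
      ≈⟨ det-expandColumn₀ n (λ i j → pow (y i) (gvExponent (suc n) (suc c) k (toℕ j))) ⟩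
    Σfin (suc n) (λ i → sign (toℕ i) * (pow (y i) (n ℕ.+ k) * gvDet n (y' i) c k))
      ≈⟨ Σ-cong (suc n) minorTerm ⟩
    Σfin (suc n) (λ i → vandermonde (suc n) y * (pow (y i) (n ℕ.+ k) * (inverseDifferences n y i * Ω n (y' i) c k)))
      ≈⟨ Σ-*ˡ (suc n) (vandermonde (suc n) y) (λ i → pow (y i) (n ℕ.+ k) * (inverseDifferences n y i * Ω n (y' i) c k)) ⟨
    vandermonde (suc n) y * Σfin (suc n) (λ i → pow (y i) (n ℕ.+ k) * (inverseDifferences n y i * Ω n (y' i) c k))
      ≈⟨ *-cong refl (Ω-regroup n c k y d c≤n) ⟩
    vandermonde (suc n) y * Ω (suc n) y (suc c) k ∎
    where
    y' : Fin (suc n) → Fin n → Carrier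
    y' i l = y (punchIn i l)
    minorTerm : ∀ i → sign (toℕ i) * (pow (y i) (n ℕ.+ k) * gvDet n (y' i) c k)
                      ≈ vandermonde (suc n) y * (pow (y i) (n ℕ.+ k) * (inverseDifferences n y i * Ω n (y' i) c k))
    minorTerm i = begin
      sign (toℕ i) * (pow (y i) (n ℕ.+ k) * gvDet n (y' i) c k)
        ≈⟨ *-cong refl (*-cong refl (generalizedVandermonde n c k c≤n (y' i) (Distinct-punchIn y d i))) ⟩
      sign (toℕ i) * (pow (y i) (n ℕ.+ k) * (vandermonde n (y' i) * Ω n (y' i) c k))
        ≈⟨ *-cong refl (*-cong refl (*-cong (vandermonde-remove n y d i) refl)) ⟩
      sign (toℕ i) * (pow (y i) (n ℕ.+ k) * ((sign (toℕ i) * (inverseDifferences n y i * vandermonde (suc n) y)) * Ω n (y' i) c k))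
        ≈⟨ solve 5 (λ s p q v o → s :* (p :* ((s :* (q :* v)) :* o)) := (s :* s) :* (v :* (p :* (q :* o)))) refl _ _ _ _ _ ⟩
      (sign (toℕ i) * sign (toℕ i)) * (vandermonde (suc n) y * (pow (y i) (n ℕ.+ k) * (inverseDifferences n y i * Ω n (y' i) c k)))
        ≈⟨ trans (*-cong (sign-sq (toℕ i)) refl) (*-identityˡ _) ⟩
      vandermonde (suc n) y * (pow (y i) (n ℕ.+ k) * (inverseDifferences n y i * Ω n (y' i) c k)) ∎

  indicator : ℕ → ℤ → Carrier
  indicator j (+ m) = if j ≡ᵇ m then 1# else 0#
  indicator j -[1+ m ] = 0#

  indicator-suc : ∀ j t → indicator (suc j) t ≈ indicator j (t ℤ.- + 1)
  indicator-suc j (+ zero) = refl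
  indicator-suc j (+ suc m) = refl
  indicator-suc j -[1+ m ] = refl

  indicator-≢ : ∀ j m → j ≢ m → indicator j (+ m) ≈ 0#
  indicator-≢ j m j≢m with j ≡ᵇ m in eq
  ... | true = ⊥-elim (j≢m (≡ᵇ-true⇒≡ j m eq))
  ... | false = refl

  ℤ-sub-suc : ∀ t a → (t ℤ.- + 1) ℤ.- + a ≡ t ℤ.- + suc a
  ℤ-sub-suc t a = ≡.trans (ℤP.+-assoc t (ℤ.- + 1) (ℤ.- + a)) (≡.cong (λ z → t ℤ.+ z) (negSuc a))
    where
    negSuc : ∀ a → ℤ.- + 1 ℤ.+ ℤ.- + a ≡ ℤ.- + suc a
    negSuc zero = ≡.refl
    negSuc (suc a) = ≡.refl

  splitAt-punchIn : ∀ k n (b : Fin (suc k)) (a : Fin (k ℕ.+ n)) →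
    splitAt (suc k) (punchIn (b ↑ˡ n) a) ≡ Sum.map₁ (punchIn b) (splitAt k a)
  splitAt-punchIn k n zero a with splitAt k a
  ... | inj₁ _ = ≡.refl
  ... | inj₂ _ = ≡.refl
  splitAt-punchIn (suc k) n (suc b) zero = ≡.refl
  splitAt-punchIn (suc k) n (suc b) (suc a) with splitAt k a | splitAt-punchIn k n b a
  ... | inj₁ _ | eq = ≡.cong (Sum.map₁ suc) eq
  ... | inj₂ _ | eq = ≡.cong (Sum.map₁ suc) eq

  Σ-indicator-in : ∀ L (g : ℕ → Carrier) m → m < L →
    Σfin L (λ l → g (toℕ l) * (if toℕ l ≡ᵇ m then 1# else 0#)) ≈ g m
  Σ-indicator-in (suc L) g zero lt = trans (+-cong (*-identityʳ _) (Σ-zero L (λ l → zeroʳ _))) (+-identityʳ _)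
  Σ-indicator-in (suc L) g (suc m) (s≤s lt) = trans (+-cong (zeroʳ _) (Σ-indicator-in L (λ t → g (suc t)) m lt)) (+-identityˡ _)

  Σ-indicator-out : ∀ L (g : ℕ → Carrier) m → L ≤ m →
    Σfin L (λ l → g (toℕ l) * (if toℕ l ≡ᵇ m then 1# else 0#)) ≈ 0#
  Σ-indicator-out zero g m le = refl
  Σ-indicator-out (suc L) g (suc m) (s≤s le) = trans (+-cong (zeroʳ _) (Σ-indicator-out L (λ t → g (suc t)) m le)) (+-identityˡ _)

  s-expansion : ∀ n (x : Fin n → Carrier) L → n ≤ L → ∀ t →
    s x t ≈ indicator 0 t + Σfin L (λ l → e (suc (toℕ l)) x * indicator (suc (toℕ l)) t)
  s-expansion n x L le -[1+ m ] = sym (trans (+-identityˡ _) (Σ-zero L (λ l → zeroʳ _)))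
  s-expansion n x L le (+ zero) = trans (e-zero n x) (sym (trans (+-cong refl (Σ-zero L (λ l → zeroʳ _))) (+-identityʳ _)))
  s-expansion n x L le (+ suc m) with ℕP.<-≤-connex m L
  ... | inj₁ m<L = sym (trans (+-identityˡ _) (Σ-indicator-in L (λ t → e (suc t) x) m m<L))
  ... | inj₂ L≤m = trans (e-beyond n (suc m) x (s≤s (ℕP.≤-trans le L≤m)))
                         (sym (trans (+-identityˡ _) (Σ-indicator-out L (λ t → e (suc t) x) m L≤m)))

  -- Position bookkeeping for deleting column c: the b-th remaining column is
  -- column skip c b of the original matrix.
  skip : ℕ → ℕ → ℕ
  skip c t = if t ℕ.<ᵇ c then t else suc t

  toℕ-punchIn : ∀ {N} (i : Fin (suc N)) (b : Fin N) → toℕ (punchIn i b) ≡ skip (toℕ i) (toℕ b)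
  toℕ-punchIn zero b = ≡.refl
  toℕ-punchIn (suc i) zero = ≡.refl
  toℕ-punchIn (suc i) (suc b) with toℕ b ℕ.<ᵇ toℕ i | toℕ-punchIn i b
  ... | true | eq = ≡.cong suc eq
  ... | false | eq = ≡.cong suc eq

  toℕ-punchIn-fromℕ< : ∀ {N c} (c<N : c < suc N) (b : Fin N) → toℕ (punchIn (fromℕ< c<N) b) ≡ skip c (toℕ b)
  toℕ-punchIn-fromℕ< c<N b = ≡.trans (toℕ-punchIn (fromℕ< c<N) b) (≡.cong (λ z → skip z (toℕ b)) (FinP.toℕ-fromℕ< c<N))

  <ᵇ-false-suc : ∀ t c → (t ℕ.<ᵇ c) ≡ false → (suc t ℕ.<ᵇ c) ≡ false
  <ᵇ-false-suc t zero eq = ≡.refl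
  <ᵇ-false-suc zero (suc c) ()
  <ᵇ-false-suc (suc t) (suc c) eq = <ᵇ-false-suc t c eq

  indicator-skip : ∀ c u t → indicator (skip c t) (+ (c ℕ.+ suc u)) ≈ indicator t (+ (c ℕ.+ u))
  indicator-skip c u t with t ℕ.<ᵇ c in eq
  ... | true = trans (indicator-≢ t _ (λ e → ℕP.<-irrefl e (ℕP.<-≤-trans t<c (ℕP.m≤m+n c (suc u)))))
                     (sym (indicator-≢ t _ (λ e → ℕP.<-irrefl e (ℕP.<-≤-trans t<c (ℕP.m≤m+n c u)))))
    where
    t<c : t < c
    t<c = ℕP.<ᵇ⇒< t c (≡.subst T (≡.sym eq) _)
  ... | false = reflexive (≡.cong (λ z → indicator (suc t) (+ z)) (ℕP.+-suc c u))

  exponent-skip : ∀ A B c t →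
    (if skip c t ℕ.<ᵇ c then A ∸ suc (skip c t) else suc B ∸ suc (skip c t))
    ≡ (if t ℕ.<ᵇ c then A ∸ suc t else B ∸ suc t)
  exponent-skip A B c t with t ℕ.<ᵇ c in eq
  ... | true rewrite eq = ≡.refl
  ... | false rewrite <ᵇ-false-suc t c eq = ≡.refl

  Σ-signedIndicator : ∀ N c (X : Fin N → Carrier) (lt : c < N) →
    Σfin N (λ j → sign (toℕ j) * (indicator (toℕ j) (+ c) * X j)) ≈ sign c * X (fromℕ< lt)
  Σ-signedIndicator (suc N) zero X lt =
    trans (+-cong (*-cong refl (*-identityˡ _)) (Σ-zero N (λ j → trans (*-cong refl (zeroˡ _)) (zeroʳ _)))) (+-identityʳ _)
  Σ-signedIndicator (suc N) (suc c) X (s≤s lt) = begin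
    sign 0 * (0# * X zero) + Σfin N (λ j → (- sign (toℕ j)) * (indicator (toℕ j) (+ c) * X (suc j)))
      ≈⟨ +-cong (trans (*-cong refl (zeroˡ _)) (zeroʳ _)) (Σ-cong N (λ j → sym (-‿distribˡ-* _ _))) ⟩
    0# + Σfin N (λ j → - (sign (toℕ j) * (indicator (toℕ j) (+ c) * X (suc j))))
      ≈⟨ trans (+-identityˡ _) (sym (Σ-neg N _)) ⟩
    - Σfin N (λ j → sign (toℕ j) * (indicator (toℕ j) (+ c) * X (suc j)))
      ≈⟨ -‿cong (Σ-signedIndicator N c (λ j → X (suc j)) lt) ⟩
    - (sign c * X (suc (fromℕ< lt)))
      ≈⟨ -‿distribˡ-* _ _ ⟩
    (- sign c) * X (suc (fromℕ< lt)) ∎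

  -- Toeplitz minors det (s_{S_b - a})_{a,b<k} of the sequence s = (e_m(x))_m,
  -- for arbitrary column positions S.  D^k_c is the case S b = c + b.
  toeplitzMinor : ∀ {n} → (Fin n → Carrier) → ∀ k → (Fin k → ℤ) → Carrier
  toeplitzMinor x k S = det k (λ a b → s x (S b ℤ.- + toℕ a))

  consecutive : ∀ c {r} → Fin r → ℤ
  consecutive c b = + (c ℕ.+ toℕ b)

  det-D : ∀ {n} (x : Fin n → Carrier) c k → det k (D x c k) ≈ toeplitzMinor x k (consecutive c)
  det-D x c k = det-cong k (λ a b → reflexive (≡.cong (s x) (index (toℕ a) (toℕ b))))
    where
    index : ∀ a b → (+ b ℤ.- + a) ℤ.+ + c ≡ + (c ℕ.+ b) ℤ.- + a
    index a b = ≡.trans (ℤP.+-comm (+ b ℤ.- + a) (+ c)) (≡.sym (ℤP.+-assoc (+ c) (+ b) (ℤ.- + a)))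

  shiftDown : ∀ {k} → (Fin (suc k) → ℤ) → Fin (suc k) → Fin k → ℤ
  shiftDown S b b' = S (punchIn b b') ℤ.- + 1

  -- First-row expansion of a Toeplitz minor: its minors are again Toeplitz
  -- minors, for the shifted positions.
  toeplitzMinor-expand : ∀ {n} (x : Fin n → Carrier) k (S : Fin (suc k) → ℤ) →
    toeplitzMinor x (suc k) S ≈ Σfin (suc k) (λ b → sign (toℕ b) * (s x (S b) * toeplitzMinor x k (shiftDown S b)))
  toeplitzMinor-expand x k S = Σ-cong (suc k) (λ b → *-cong (refl {sign (toℕ b)})
    (*-cong (reflexive (≡.cong (s x) (ℤP.+-identityʳ (S b))))
            (det-cong k (λ a b' → reflexive (≡.cong (s x) (≡.sym (ℤ-sub-suc (S (punchIn b b')) (toℕ a))))))))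

  Σ-*ʳ : ∀ n c (f : Fin n → Carrier) → Σfin n f * c ≈ Σfin n (λ i → f i * c)
  Σ-*ʳ n c f = trans (*-comm _ c) (trans (Σ-*ˡ n c f) (Σ-cong n (λ i → *-comm c (f i))))

  -- Let y be roots of t ↦ Σ_m e_m(x) t^{n-m}
  -- (in the form: eSum x (y i) M = 0 for M > n).  Stack k unit rows, row b
  -- having its 1 in column S b, on top of the n power rows (y_i^{k+n-1-j}).
  -- Then det = det (s_{S_b - a})_{a,b} · V(y): adding Σ_l e_{l+1}·(column l+1)
  -- to column 0 turns it into (s_{S b}) on top of zeros, and expanding along
  -- column 0 leaves block matrices of the same shape with k-1 unit rows.

  module ToeplitzBlock (n : ℕ) (x y : Fin n → Carrier)
                       (root : ∀ i M → n < M → eSum x (y i) M ≈ 0#) where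

    blockRow : ∀ {k} → (Fin k → ℤ) → (Fin (k ℕ.+ n) → ℕ) → Fin k ⊎ Fin n → Fin (k ℕ.+ n) → Carrier
    blockRow S ex (inj₁ b) j = indicator (toℕ j) (S b)
    blockRow S ex (inj₂ i) j = pow (y i) (ex j)

    blockMatrix : ∀ k → (Fin k → ℤ) → (Fin (k ℕ.+ n) → ℕ) → Matrix (k ℕ.+ n)
    blockMatrix k S ex r j = blockRow S ex (splitAt k r) j

    standardExponent : ∀ k → Fin (k ℕ.+ n) → ℕ
    standardExponent k j = (k ℕ.+ n) ∸ suc (toℕ j)

    eliminatedEntry₀ : ∀ {k} → (Fin (suc k) → ℤ) → Fin (suc k) ⊎ Fin n → Carrier
    eliminatedEntry₀ S (inj₁ b) = s x (S b)
    eliminatedEntry₀ S (inj₂ i) = 0#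

    eliminatedRow : ∀ {k} → (Fin (suc k) → ℤ) → Fin (suc k) ⊎ Fin n → Fin (suc (k ℕ.+ n)) → Carrier
    eliminatedRow S u zero = eliminatedEntry₀ S u
    eliminatedRow {k} S u (suc j) = blockRow S (standardExponent (suc k)) u (suc j)

    eliminated : ∀ k → (Fin (suc k) → ℤ) → Matrix (suc (k ℕ.+ n))
    eliminated k S r j = eliminatedRow S (splitAt (suc k) r) j

    blockMatrix-eliminate : ∀ k (S : Fin (suc k) → ℤ) →
      det (suc (k ℕ.+ n)) (blockMatrix (suc k) S (standardExponent (suc k))) ≈ det (suc (k ℕ.+ n)) (eliminated k S)
    blockMatrix-eliminate k S =
      sym (det-addColumns₀ (k ℕ.+ n) (k ℕ.+ n) (blockMatrix (suc k) S (standardExponent (suc k))) (eliminated k S) (λ l → e (suc (toℕ l)) x) (λ l → l)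
             (λ r → column₀ (splitAt (suc k) r)) (λ r j → refl))
      where
      column₀ : ∀ u → eliminatedRow S u zero
                      ≈ blockRow S (standardExponent (suc k)) u zero
                        + Σfin (k ℕ.+ n) (λ l → e (suc (toℕ l)) x * blockRow S (standardExponent (suc k)) u (suc l))
      column₀ (inj₁ b) = s-expansion n x (k ℕ.+ n) (ℕP.m≤n+m n k) (S b)
      column₀ (inj₂ i) = sym (trans (+-cong (sym (trans (*-cong (e-zero n x) refl) (*-identityˡ _))) refl)
                                    (root i (suc (k ℕ.+ n)) (s≤s (ℕP.m≤n+m n k))))

    minorRow : ∀ {k} (S : Fin (suc k) → ℤ) (u : Fin k ⊎ Fin n) (b : Fin (suc k)) (j : Fin (k ℕ.+ n)) →
      eliminatedRow S (Sum.map₁ (punchIn b) u) (suc j) ≈ blockRow (shiftDown S b) (standardExponent k) u j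
    minorRow S (inj₁ b') b j = indicator-suc (toℕ j) (S (punchIn b b'))
    minorRow S (inj₂ i) b j = refl

    eliminated-expand : ∀ k (S : Fin (suc k) → ℤ) →
      det (suc (k ℕ.+ n)) (eliminated k S)
      ≈ Σfin (suc k) (λ b → sign (toℕ b) * (s x (S b) * det (k ℕ.+ n) (blockMatrix k (shiftDown S b) (standardExponent k))))
    eliminated-expand k S = begin
      det (suc (k ℕ.+ n)) M
        ≈⟨ det-expandColumn₀ (k ℕ.+ n) M ⟩
      Σfin (suc k ℕ.+ n) term
        ≈⟨ Σ-++ (suc k) n term ⟩
      Σfin (suc k) (λ b → term (b ↑ˡ n)) + Σfin n (λ i → term (suc k ↑ʳ i))
        ≈⟨ +-cong (Σ-cong (suc k) unitTerm) (Σ-zero n powerTerm) ⟩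
      Σfin (suc k) (λ b → sign (toℕ b) * (s x (S b) * det (k ℕ.+ n) (blockMatrix k (shiftDown S b) (standardExponent k)))) + 0#
        ≈⟨ +-identityʳ _ ⟩
      Σfin (suc k) (λ b → sign (toℕ b) * (s x (S b) * det (k ℕ.+ n) (blockMatrix k (shiftDown S b) (standardExponent k)))) ∎
      where
      M : Matrix (suc (k ℕ.+ n))
      M = eliminated k S
      term : Fin (suc (k ℕ.+ n)) → Carrier
      term r = sign (toℕ r) * (M r zero * det (k ℕ.+ n) (λ a j → M (punchIn r a) (suc j)))
      unitTerm : ∀ b → term (b ↑ˡ n) ≈ sign (toℕ b) * (s x (S b) * det (k ℕ.+ n) (blockMatrix k (shiftDown S b) (standardExponent k)))
      unitTerm b = *-cong (reflexive (≡.cong sign (FinP.toℕ-↑ˡ b n)))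
        (*-cong (reflexive (≡.cong (λ u → eliminatedRow S u zero) (FinP.splitAt-↑ˡ (suc k) b n)))
                (det-cong (k ℕ.+ n) (λ a j →
                  trans (reflexive (≡.cong (λ u → eliminatedRow S u (suc j)) (splitAt-punchIn k n b a)))
                        (minorRow S (splitAt k a) b j))))
      powerTerm : ∀ i → term (suc k ↑ʳ i) ≈ 0#
      powerTerm i = trans (*-cong refl (trans (*-cong (reflexive (≡.cong (λ u → eliminatedRow S u zero) (FinP.splitAt-↑ʳ (suc k) n i))) refl)
                                              (zeroˡ _)))
                          (zeroʳ _)

    V : Carrier
    V = vandermonde n y

    blockMatrix-det : ∀ k (S : Fin k → ℤ) →
      det (k ℕ.+ n) (blockMatrix k S (standardExponent k)) ≈ toeplitzMinor x k S * V
    blockMatrix-det zero S = sym (*-identityˡ V)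
    blockMatrix-det (suc k) S = begin
      det (suc (k ℕ.+ n)) (blockMatrix (suc k) S (standardExponent (suc k)))
        ≈⟨ trans (blockMatrix-eliminate k S) (eliminated-expand k S) ⟩
      Σfin (suc k) (λ b → sign (toℕ b) * (s x (S b) * det (k ℕ.+ n) (blockMatrix k (shiftDown S b) (standardExponent k))))
        ≈⟨ Σ-cong (suc k) (λ b → *-cong (refl {sign (toℕ b)}) (*-cong (refl {s x (S b)}) (blockMatrix-det k (shiftDown S b)))) ⟩
      Σfin (suc k) (λ b → sign (toℕ b) * (s x (S b) * (toeplitzMinor x k (shiftDown S b) * V)))
        ≈⟨ Σ-cong (suc k) (λ b → solve 4 (λ g a f v → g :* (a :* (f :* v)) := (g :* (a :* f)) :* v) refl
                                     (sign (toℕ b)) (s x (S b)) (toeplitzMinor x k (shiftDown S b)) V) ⟩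
      Σfin (suc k) (λ b → (sign (toℕ b) * (s x (S b) * toeplitzMinor x k (shiftDown S b))) * V)
        ≈⟨ Σ-*ʳ (suc k) V (λ b → sign (toℕ b) * (s x (S b) * toeplitzMinor x k (shiftDown S b))) ⟨
      Σfin (suc k) (λ b → sign (toℕ b) * (s x (S b) * toeplitzMinor x k (shiftDown S b))) * V
        ≈⟨ *-cong (toeplitzMinor-expand x k S) refl ⟨
      toeplitzMinor x (suc k) S * V ∎

    -- Exponents of the power rows once K - r of the K unit rows are deleted.
    shiftedExponent : ℕ → ℕ → ∀ r → Fin (r ℕ.+ n) → ℕ
    shiftedExponent K c r j = if toℕ j ℕ.<ᵇ c then (n ℕ.+ K) ∸ suc (toℕ j) else (r ℕ.+ n) ∸ suc (toℕ j)

    shiftedExponent-full : ∀ K c j → shiftedExponent K c K j ≡ standardExponent K j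
    shiftedExponent-full K c j with toℕ j ℕ.<ᵇ c
    ... | true = ≡.cong (_∸ suc (toℕ j)) (ℕP.+-comm n K)
    ... | false = ≡.refl

    blockRow-deleteColumn : ∀ K c r (c<N : c < suc (r ℕ.+ n)) (u : Fin r ⊎ Fin n) b →
      blockRow (consecutive c) (shiftedExponent K c (suc r)) (Sum.map₁ suc u) (punchIn (fromℕ< c<N) b)
      ≈ blockRow (consecutive c) (shiftedExponent K c r) u b
    blockRow-deleteColumn K c r c<N (inj₁ b') b =
      trans (reflexive (≡.cong (λ z → indicator z (+ (c ℕ.+ suc (toℕ b')))) (toℕ-punchIn-fromℕ< c<N b)))
            (indicator-skip c (toℕ b') (toℕ b))
    blockRow-deleteColumn K c r c<N (inj₂ i) b = reflexive (≡.cong (pow (y i))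
      (≡.trans (≡.cong (λ z → if z ℕ.<ᵇ c then (n ℕ.+ K) ∸ suc z else (suc r ℕ.+ n) ∸ suc z) (toℕ-punchIn-fromℕ< c<N b))
               (exponent-skip (n ℕ.+ K) (r ℕ.+ n) c (toℕ b))))

    -- Expanding along the unit rows, one at a time: each is the unit vector
    -- at column c and costs the sign (-1)^c.
    blockMatrix-deleteUnitRows : ∀ K c r → c ≤ n →
      det (r ℕ.+ n) (blockMatrix r (consecutive c) (shiftedExponent K c r)) ≈ pow (sign c) r * gvDet n y c K
    blockMatrix-deleteUnitRows K c zero c≤n = sym (*-identityˡ _)
    blockMatrix-deleteUnitRows K c (suc r) c≤n = begin
      det (suc (r ℕ.+ n)) M
        ≈⟨ Σ-cong (suc (r ℕ.+ n)) (λ j → *-cong (refl {sign (toℕ j)})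
             (*-cong (reflexive (≡.cong (λ z → indicator (toℕ j) (+ z)) (ℕP.+-identityʳ c))) (refl {minor j}))) ⟩
      Σfin (suc (r ℕ.+ n)) (λ j → sign (toℕ j) * (indicator (toℕ j) (+ c) * minor j))
        ≈⟨ Σ-signedIndicator (suc (r ℕ.+ n)) c minor c<N ⟩
      sign c * minor (fromℕ< c<N)
        ≈⟨ *-cong refl (det-cong (r ℕ.+ n) (λ a b → blockRow-deleteColumn K c r c<N (splitAt r a) b)) ⟩
      sign c * det (r ℕ.+ n) (blockMatrix r (consecutive c) (shiftedExponent K c r))
        ≈⟨ *-cong refl (blockMatrix-deleteUnitRows K c r c≤n) ⟩
      sign c * (pow (sign c) r * gvDet n y c K)
        ≈⟨ *-assoc _ _ _ ⟨
      pow (sign c) (suc r) * gvDet n y c K ∎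
      where
      M : Matrix (suc (r ℕ.+ n))
      M = blockMatrix (suc r) (consecutive c) (shiftedExponent K c (suc r))
      minor : Fin (suc (r ℕ.+ n)) → Carrier
      minor j = det (r ℕ.+ n) (λ a b → M (suc a) (punchIn j b))
      c<N : c < suc (r ℕ.+ n)
      c<N = s≤s (ℕP.≤-trans c≤n (ℕP.m≤n+m n r))

    toeplitzMinor-consecutive : ∀ K c → c ≤ n → toeplitzMinor x K (consecutive c) * V ≈ pow (sign c) K * gvDet n y c K
    toeplitzMinor-consecutive K c c≤n = begin
      toeplitzMinor x K (consecutive c) * V
        ≈⟨ blockMatrix-det K (consecutive c) ⟨
      det (K ℕ.+ n) (blockMatrix K (consecutive c) (standardExponent K))
        ≈⟨ det-cong (K ℕ.+ n) (λ r j → sameExponents (splitAt K r) j) ⟨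
      det (K ℕ.+ n) (blockMatrix K (consecutive c) (shiftedExponent K c K))
        ≈⟨ blockMatrix-deleteUnitRows K c K c≤n ⟩
      pow (sign c) K * gvDet n y c K ∎
      where
      sameExponents : ∀ u j → blockRow (consecutive c) (shiftedExponent K c K) u j
                              ≈ blockRow (consecutive c) (standardExponent K) u j
      sameExponents (inj₁ b) j = refl
      sameExponents (inj₂ i) j = reflexive (≡.cong (pow (y i)) (shiftedExponent-full K c j))

  Distinct-neg : ∀ {n} (x : Fin n → Carrier) → Distinct x → Distinct (λ i → - x i)
  Distinct-neg x d i j i≢j eq = d i j i≢j (trans (sym (-‿involutive (x i))) (trans (-‿cong eq) (-‿involutive (x j))))

  pow-sign-comm : ∀ m n → pow (sign m) n ≈ pow (sign n) m
  pow-sign-comm m n = trans (pow-sign m n) (trans (reflexive (≡.cong sign (ℕP.*-comm m n))) (sym (pow-sign n m)))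

  pow-sign-sq : ∀ m n → pow (sign m) n * pow (sign m) n ≈ 1#
  pow-sign-sq m n = trans (*-cong (pow-sign m n) (pow-sign m n)) (sign-sq (m ℕ.* n))

  ratio-neg : ∀ a b → ¬ (a ≈ b) → (- a) / ((- a) - (- b)) ≈ a / (a - b)
  ratio-neg a b a≉b = begin
    (- a) * ((- a) - (- b)) ⁻¹     ≈⟨ *-cong refl (⁻¹-cong (-‿+-comm a (- b))) ⟩
    (- a) * (- (a - b)) ⁻¹         ≈⟨ *-cong refl (⁻¹-neg (a - b) (difference-nonzero a≉b)) ⟩
    (- a) * (- (a - b) ⁻¹)         ≈⟨ neg-*-neg _ _ ⟩
    a * (a - b) ⁻¹                 ∎

  in≢out : ∀ {n} (τ : Subset n) i j → lookup τ i ≡ true → lookup τ j ≡ false → i ≢ j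
  in≢out τ i j i∈τ j∉τ ≡.refl with ≡.trans (≡.sym i∈τ) j∉τ
  ... | ()

  subsetTerm-neg : ∀ {n} (x : Fin n → Carrier) → Distinct x → ∀ k τ →
    subsetTerm (λ i → - x i) k τ ≈ pow (sign ∣ τ ∣) k * subsetTerm x k τ
  subsetTerm-neg x d k τ = begin
    Πin τ (λ i → pow (- x i) k) * Πin τ (λ i → Πout τ (λ j → (- x i) / ((- x i) - (- x j))))
      ≈⟨ *-cong (Πin-cong τ (λ i _ → pow-neg (x i) k))
                (Πin-cong τ (λ i i∈τ → Πout-cong τ (λ j j∉τ → ratio-neg (x i) (x j) (d i j (in≢out τ i j i∈τ j∉τ))))) ⟩
    Πin τ (λ i → sign k * pow (x i) k) * Πin τ (λ i → Πout τ (λ j → x i / (x i - x j)))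
      ≈⟨ *-cong (trans (Πin-* τ (λ _ → sign k) (λ i → pow (x i) k)) (*-cong (Πin-const τ (sign k)) refl)) refl ⟩
    (pow (sign k) ∣ τ ∣ * Πin τ (λ i → pow (x i) k)) * Πin τ (λ i → Πout τ (λ j → x i / (x i - x j)))
      ≈⟨ trans (*-assoc _ _ _) (*-cong (pow-sign-comm k ∣ τ ∣) refl) ⟩
    pow (sign ∣ τ ∣) k * subsetTerm x k τ ∎

  Ω-neg : ∀ n (x : Fin n → Carrier) → Distinct x → ∀ c k → Ω n (λ i → - x i) c k ≈ pow (sign c) k * Ω n x c k
  Ω-neg n x d c k = begin
    ΣSub n (λ τ → guard (∣ τ ∣ ≡ᵇ c) (subsetTerm (λ i → - x i) k τ))
      ≈⟨ ΣSub-cong n (λ τ → guard-≡ᵇ-cong ∣ τ ∣ c (λ ∣τ∣≡c →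
           trans (subsetTerm-neg x d k τ) (reflexive (≡.cong (λ m → pow (sign m) k * subsetTerm x k τ) ∣τ∣≡c)))) ⟩
    ΣSub n (λ τ → guard (∣ τ ∣ ≡ᵇ c) (pow (sign c) k * subsetTerm x k τ))
      ≈⟨ ΣSub-cong n (λ τ → guard-* (∣ τ ∣ ≡ᵇ c) _ _) ⟩
    ΣSub n (λ τ → pow (sign c) k * guard (∣ τ ∣ ≡ᵇ c) (subsetTerm x k τ))
      ≈⟨ ΣSub-*ˡ n _ _ ⟨
    pow (sign c) k * Ω n x c k ∎


-- V(y) · det D^k_c = ε G(y) = ε V(y) Ω(y) = ε² V(y) Ω(x) with ε = (-1)^{ck},
-- y = -x, and V(y) ≠ 0 cancels.
theorem4 : ∀ {a ℓ : Level} (F : Field a ℓ) → let open FieldOps F in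
    (n c : ℕ) → n ≥ 1 → c ≤ n →
    (x : Fin n → Carrier) → (∀ i j → i ≢ j → ¬ (x i ≈ x j)) →
    (k : ℕ) → k ≥ 1 →
    det k (D x c k) ≈
    ΣSubCard n c (λ τ → Πin τ (λ i → pow (x i) k) * Πin τ (λ i → Πout τ (λ j → x i / (x i - x j))))
theorem4 F n c _ c≤n x distinct k _ =
  *-cancelˡ-nonzero V _ _ (vandermonde-nonzero n y distinct-y) (begin
    V * det k (D x c k)                       ≈⟨ *-cong refl (det-D x c k) ⟩
    V * toeplitzMinor x k (consecutive c)     ≈⟨ *-comm _ _ ⟩
    toeplitzMinor x k (consecutive c) * V     ≈⟨ toeplitzMinor-consecutive k c c≤n ⟩
    ε * gvDet n y c k                         ≈⟨ *-cong refl (generalizedVandermonde n c k c≤n y distinct-y) ⟩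
    ε * (V * Ω n y c k)                       ≈⟨ *-cong refl (*-cong refl (Ω-neg n x distinct c k)) ⟩
    ε * (V * (ε * Ω n x c k))                 ≈⟨ solve 3 (λ s v r → s :* (v :* (s :* r)) := v :* ((s :* s) :* r)) refl ε V _ ⟩
    V * ((ε * ε) * Ω n x c k)                 ≈⟨ *-cong refl (trans (*-cong (pow-sign-sq c k) refl) (*-identityˡ _)) ⟩
    V * Ω n x c k                             ∎)
  where
  open FieldOps F hiding (zero)
  open ShiftedToeplitz F
  open import Relation.Binary.Reasoning.Setoid setoid
  open import Algebra.Solver.Ring.NaturalCoefficients.Default (CommutativeRing.commutativeSemiring commutativeRing)
    using (solve; _:=_; _:*_)
  y : Fin n → Carrier
  y i = - x i
  distinct-y : Distinct y
  distinct-y = Distinct-neg x distinct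
  open ToeplitzBlock n x y (λ i M n<M → eSum-root n x i M n<M)
  ε : Carrier
  ε = pow (sign c) k
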